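{- For every nonnegative integer $L$ and $a\in\{0,1\}$, \[ G_{(L+1,L,L)/(1-a,0,0)/2}(z,q)= \frac{1}{(zq;q)_{3L+a}}\,\sum_{n=0}^{\infty} z^n q^{n(n+a)} {3L-n \brack n}. \]
   Context: Cylindric partitions of shape $\lambda/\mu/d$: let $r\geq1$, and let $\lambda=(\lambda_1\geq\dots\geq\lambda_r\geq0)$, $\mu=(\mu_1\geq\dots\geq\mu_r\geq0)$ be integer sequences with $\mu_i\leq\lambda_i$ for all $i$, and $d$ an integer with $d\geq\max\{\mu_1-\mu_r,\lambda_1-\lambda_r\}$. A cylindric partition of shape $\lambda/\mu/d$ (on $\mathbb{N}_0$) is a tuple $(\nu^{(1)},\dots,\nu^{(r)})$ where $\nu^{(i)}=(\nu^{(i)}_1\geq\dots\geq\nu^{(i)}_{\lambda_i-\mu_i})$ is a weakly decreasing sequence of nonnegative integers of length $\lambda_i-\mu_i$, such that $\nu^{(i)}_j\geq\nu^{(i+1)}_{j+\mu_i-\mu_{i+1}}$ for $1\leq i\leq r-1$ and $1\leq j\leq\lambda_{i+1}-\mu_i$, and $\nu^{(r)}_j\geq\nu^{(1)}_{j-\mu_1+\mu_r+d}$ for $1\leq j\leq\lambda_1-\mu_r-d$. (Equivalently, a filling of the skew diagram $\lambda/\mu$ with weakly decreasing rows and columns which remains so when row $r$, shifted $d$ units right, is placed above row $1$.) Its size is the sum of all entries and $\max$ is the largest entry (taken to be $0$ if there are no entries). $G_{\lambda/\mu/d}(z,q):=\sum_\pi z^{\max(\pi)}q^{|\pi|}$ over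 all such $\pi$. Notation: $(x;q)_n=\prod_{i=0}^{n-1}(1-xq^i)$; ${n\brack m}=\frac{(q;q)_n}{(q;q)_m(q;q)_{n-m}}$ if $0\leq m\leq n$ and $0$ otherwise. -}

module Defs where

open import Data.Nat using (ℕ; zero; suc; _+_; _*_; _∸_; _≤_; _<_; _⊔_; _≤ᵇ_; _≡ᵇ_)
open import Data.Bool using (Bool; true; false; if_then_else_; _∧_)
open import Data.Integer using (ℤ; +_) renaming (_+_ to _+ℤ_; _*_ to _*ℤ_; _-_ to _-ℤ_)
open import Data.List using (List; []; _∷_; length; map; foldr; upTo)
open import Data.Nat.ListAction using (sum)
open import Data.List.Membership.Propositional using (_∈_)
open import Data.List.Relation.Unary.Unique.Propositional using (Unique)
open import Data.Product using (Σ; _×_)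
open import Function.Bundles using (_⇔_)
open import Relation.Binary.PropositionalEquality using (_≡_)

get : {A : Set} → A → List A → ℕ → A
get d []       _       = d
get d (x ∷ xs) zero    = x
get d (x ∷ xs) (suc n) = get d xs n

record Shape : Set where
  constructor shape
  field
    lam : List ℕ
    mu  : List ℕ
    d   : ℕ

-- λ_i , μ_i for 1-based i
lamAt : Shape → ℕ → ℕ
lamAt s i = get 0 (Shape.lam s) (i ∸ 1)

muAt : Shape → ℕ → ℕ
muAt s i = get 0 (Shape.mu s) (i ∸ 1)

rank : Shape → ℕ
rank s = length (Shape.lam s)

-- ν⁽ⁱ⁾ (1-based i) and ν⁽ⁱ⁾_j (1-based i, j)
row : List (List ℕ) → ℕ → List ℕ
row ν i = get [] ν (i ∸ 1)

ent : List (List ℕ) → ℕ → ℕ → ℕ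
ent ν i j = get 0 (row ν i) (j ∸ 1)

record IsCylindric (s : Shape) (ν : List (List ℕ)) : Set where
  field
    nrows   : length ν ≡ rank s
    rowlen  : ∀ i → 1 ≤ i → i ≤ rank s → length (row ν i) ≡ lamAt s i ∸ muAt s i
    rowdec  : ∀ i j → 1 ≤ i → i ≤ rank s → 1 ≤ j → j < length (row ν i) →
              ent ν i (suc j) ≤ ent ν i j
    coldec  : ∀ i j → 1 ≤ i → suc i ≤ rank s → 1 ≤ j →
              j ≤ lamAt s (suc i) ∸ muAt s i →
              ent ν (suc i) (j + (muAt s i ∸ muAt s (suc i))) ≤ ent ν i j
    cycdec  : ∀ j → 1 ≤ j → j ≤ lamAt s 1 ∸ (muAt s (rank s) + Shape.d s) →
              ent ν 1 ((j + muAt s (rank s) + Shape.d s) ∸ muAt s 1) ≤ ent ν (rank s) j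

size : List (List ℕ) → ℕ
size ν = sum (map sum ν)

maxEntry : List (List ℕ) → ℕ
maxEntry ν = foldr _⊔_ 0 (map (foldr _⊔_ 0) ν)

-- k is the number of cylindric partitions π of shape s with max π = m and |π| = N:
-- there is a duplicate-free list of length k whose members are exactly those π.
CountIs : Shape → ℕ → ℕ → ℕ → Set
CountIs s m N k =
  Σ (List (List (List ℕ))) λ xs →
    length xs ≡ k × Unique xs ×
    (∀ ν → (ν ∈ xs) ⇔ (IsCylindric s ν × maxEntry ν ≡ m × size ν ≡ N))

-- Formal power series in z, q with integer coefficients:
-- f i t is the coefficient of z^i q^t.

Series : Set
Series = ℕ → ℕ → ℤ

Σ≤ : ℕ → (ℕ → ℤ) → ℤ
Σ≤ n f = foldr (λ i acc → f i +ℤ acc) (+ 0) (upTo (suc n))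

mul : Series → Series → Series
mul f g m N = Σ≤ m λ i → Σ≤ N λ j → f i j *ℤ g (m ∸ i) (N ∸ j)

one : Series
one i t = if (i ≡ᵇ 0) ∧ (t ≡ᵇ 0) then + 1 else + 0

oneMinusZQ : ℕ → Series
oneMinusZQ e i t =
  if (i ≡ᵇ 0) ∧ (t ≡ᵇ 0) then + 1 else
  (if (i ≡ᵇ 1) ∧ (t ≡ᵇ e) then Data.Integer.-_ (+ 1) else + 0)

pochZQ : ℕ → Series
pochZQ zero    = one
pochZQ (suc k) = mul (pochZQ k) (oneMinusZQ (suc k))

-- Gaussian binomial [n, m]_q; qbin n m t = coefficient of q^t.
-- Defined by the q-Pascal recurrence [n+1, m+1] = [n, m] + q^{m+1} [n, m+1],
-- [n, 0] = 1, [0, m+1] = 0 (so [n, m] = 0 for m > n).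
qbin : ℕ → ℕ → ℕ → ℕ
qbin n       zero    t = if t ≡ᵇ 0 then 1 else 0
qbin zero    (suc m) t = 0
qbin (suc n) (suc m) t =
  qbin n m t + (if suc m ≤ᵇ t then qbin n (suc m) (t ∸ suc m) else 0)

-- Coefficient series of  Σ_{n ≥ 0} z^n q^{n(n+a)} [3L-n, n]
-- (the coefficient of z^n q^t; [3L-n, n] = 0 when 3L-n < n, including 3L-n < 0,
-- which matches 3L ∸ n = 0 < n).
rhsSeries : ℕ → ℕ → Series
rhsSeries L a n t =
  if n * (n + a) ≤ᵇ t then + qbin (3 * L ∸ n) n (t ∸ n * (n + a)) else + 0

shapeLa : ℕ → ℕ → Shape
shapeLa L a = shape (suc L ∷ L ∷ L ∷ []) ((1 ∸ a) ∷ 0 ∷ 0 ∷ []) 2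

{-# OPTIONS --termination-depth=3 #-}
module Submission where

-- Reading a cylindric partition of shape (L+1,L,L)/(1-a,0,0)/2 column by column, in the row order
-- 2, 1, 3 (after the extra first cell of row 1 when a = 1), turns it into a sequence x of length
-- n = 3L + a with x(i+2) ≤ x(i) and x(i+3) ≤ x(i), and x(1) ≤ x(0) when a = 1; call it a fence.
-- A fence either has only positive entries (subtract 1 from all of them), or ends in 0 (drop it),
-- or ends in 0, c with c ≥ 1, in which case every other entry is at least c (subtract c).  For the
-- generating function G(n) of fences by maximum and size this gives
--   (1 - zq^n) G(n) = G(n-1) + zq^(n-1) G(n-2) / (1 - zq^(n-1)),
-- so H(n) = (zq;q)_n G(n) satisfies H(n) = H(n-1) + zq^(n-1) H(n-2), except that for a = 1 the
-- last term is absent at n = 2.  By the dual q-Pascal rule the sums Σ z^m q^(m(m+a)) [N-m, m]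
-- satisfy the same recurrence as H(N+a), with the same two initial terms.

open import Defs
open import Algebra.Bundles using (CommutativeMonoid)
open import Data.Bool using (true; false; if_then_else_)
open import Data.Empty using (⊥-elim)
import Data.Fin as Fin
open import Data.Integer using (ℤ; +_; -_) renaming (_+_ to _+ℤ_; _*_ to _*ℤ_; _-_ to _-ℤ_)
import Data.Integer.Properties as ℤₚ
import Data.Integer.Solver as ℤ-Solver
open import Data.List using (List; []; _∷_; _++_; _∷ʳ_; length; map; foldr; drop; applyUpTo)
open import Data.List.Membership.Propositional using (_∈_)
open import Data.List.Membership.Propositional.Properties using (∈-++⁻; ∈-++⁺ˡ; ∈-++⁺ʳ; ∈-map⁺; ∈-map⁻)
open import Data.List.Properties using (length-map; length-++; map-injective; ∷ʳ-injectiveˡ; ++-cancelʳ)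
import Data.List.Relation.Unary.All as All
import Data.List.Relation.Unary.All.Properties as Allₚ
open import Data.List.Relation.Unary.AllPairs using ([]; _∷_)
open import Data.List.Relation.Unary.Any using (here; there)
open import Data.List.Relation.Unary.Unique.Propositional using (Unique)
import Data.List.Relation.Unary.Unique.Propositional.Properties as Unique
open import Data.Nat using (ℕ; zero; suc; _+_; _*_; _∸_; _⊔_; _≤_; _<_; _≤ᵇ_; _≡ᵇ_; z≤n; s≤s)
open import Data.Nat.ListAction using (sum)
open import Data.Nat.ListAction.Properties using (sum-++)
import Data.Nat.Properties as ℕₚ
open import Algebra.Properties.CommutativeSemigroup ℕₚ.+-commutativeSemigroup using (interchange; x∙yz≈y∙xz)
import Data.Nat.Solver as ℕ-Solver
open import Data.Product using (Σ-syntax; _×_; _,_; proj₁; proj₂; uncurry)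
open import Data.Sum using (_⊎_; inj₁; inj₂)
open import Data.Unit using (⊤; tt)
open import Data.Vec using ([]; _∷_)
open import Function using (_∘_; case_of_)
open import Function.Bundles using (_⇔_; mk⇔; Equivalence)
open import Level using (0ℓ)
open import Relation.Binary.Definitions using (tri<; tri≈; tri>)
open import Relation.Binary.PropositionalEquality
open import Relation.Nullary using (yes; no; ¬_)

-- Coefficient shifts and finite sums

-- On coefficient sequences with zero o, shift o e is multiplication by q^e.
shift : {A : Set} → A → ℕ → (ℕ → A) → ℕ → A
shift o zero    f t       = f t
shift o (suc e) f zero    = o
shift o (suc e) f (suc t) = shift o e f t

module _ {A : Set} {o : A} where

  shift-cong : ∀ e {f g : ℕ → A} → (∀ t → f t ≡ g t) → ∀ t → shift o e f t ≡ shift o e g t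
  shift-cong zero    f≗g t       = f≗g t
  shift-cong (suc e) f≗g zero    = refl
  shift-cong (suc e) f≗g (suc t) = shift-cong e f≗g t

  shift-vanishing : ∀ e {f : ℕ → A} → (∀ t → f t ≡ o) → ∀ t → shift o e f t ≡ o
  shift-vanishing zero    f≗o t       = f≗o t
  shift-vanishing (suc e) f≗o zero    = refl
  shift-vanishing (suc e) f≗o (suc t) = shift-vanishing e f≗o t

  shift-shift : ∀ a b (f : ℕ → A) t → shift o a (shift o b f) t ≡ shift o (a + b) f t
  shift-shift zero    b f t       = refl
  shift-shift (suc a) b f zero    = refl
  shift-shift (suc a) b f (suc t) = shift-shift a b f t

  shift-+ : ∀ e (f : ℕ → A) t → shift o e f (e + t) ≡ f t
  shift-+ zero    f t = refl
  shift-+ (suc e) f t = shift-+ e f t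

  shift-if : ∀ e (f : ℕ → A) t → (if e ≤ᵇ t then f (t ∸ e) else o) ≡ shift o e f t
  shift-if zero          f t       = refl
  shift-if (suc e)       f zero    = refl
  shift-if (suc zero)    f (suc t) = refl
  shift-if (suc (suc e)) f (suc t) = shift-if (suc e) f t

  shift-map : {B : Set} {o′ : B} (h : A → B) → h o ≡ o′ →
              ∀ e (f : ℕ → A) t → shift o′ e (h ∘ f) t ≡ h (shift o e f t)
  shift-map h ho zero    f t       = refl
  shift-map h ho (suc e) f zero    = sym ho
  shift-map h ho (suc e) f (suc t) = shift-map h ho e f t

  shift-preserves : (P : A → Set) → P o → ∀ e {f : ℕ → A} → (∀ t → P (f t)) → ∀ t → P (shift o e f t)
  shift-preserves P Po zero    Pf t       = Pf t
  shift-preserves P Po (suc e) Pf zero    = Po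
  shift-preserves P Po (suc e) Pf (suc t) = shift-preserves P Po e Pf t

  shift-zipWith : (_∙_ : A → A → A) → o ∙ o ≡ o → ∀ e (f g : ℕ → A) t →
                  shift o e (λ k → f k ∙ g k) t ≡ shift o e f t ∙ shift o e g t
  shift-zipWith _∙_ oo zero    f g t       = refl
  shift-zipWith _∙_ oo (suc e) f g zero    = sym oo
  shift-zipWith _∙_ oo (suc e) f g (suc t) = shift-zipWith _∙_ oo e f g t

∑< : ℕ → (ℕ → ℤ) → ℤ
∑< zero    f = + 0
∑< (suc n) f = f 0 +ℤ ∑< n (f ∘ suc)

Σ≤-∑< : ∀ n f → Σ≤ n f ≡ ∑< (suc n) f
Σ≤-∑< n f = foldr-applyUpTo (suc n) (λ i → i)
  where
  foldr-applyUpTo : ∀ k (g : ℕ → ℕ) →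
    foldr (λ i acc → f i +ℤ acc) (+ 0) (applyUpTo g k) ≡ ∑< k (f ∘ g)
  foldr-applyUpTo zero    g = refl
  foldr-applyUpTo (suc k) g = cong (f (g 0) +ℤ_) (foldr-applyUpTo k (g ∘ suc))

∑<-cong : ∀ n {f g : ℕ → ℤ} → (∀ i → i < n → f i ≡ g i) → ∑< n f ≡ ∑< n g
∑<-cong zero    f≗g = refl
∑<-cong (suc n) f≗g = cong₂ _+ℤ_ (f≗g 0 (s≤s z≤n)) (∑<-cong n (λ i i<n → f≗g (suc i) (s≤s i<n)))

∑<-zero : ∀ n {f : ℕ → ℤ} → (∀ i → f i ≡ + 0) → ∑< n f ≡ + 0
∑<-zero zero    f≗0 = refl
∑<-zero (suc n) f≗0 = cong₂ _+ℤ_ (f≗0 0) (∑<-zero n (f≗0 ∘ suc))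

∑<-− : ∀ n (f g : ℕ → ℤ) → ∑< n (λ i → f i -ℤ g i) ≡ ∑< n f -ℤ ∑< n g
∑<-− zero    f g = refl
∑<-− (suc n) f g = trans (cong ((f 0 -ℤ g 0) +ℤ_) (∑<-− n (f ∘ suc) (g ∘ suc)))
  (solve 4 (λ a b c d → (a :- b) :+ (c :- d) := (a :+ c) :- (b :+ d)) refl
     (f 0) (g 0) (∑< n (f ∘ suc)) (∑< n (g ∘ suc)))
  where open ℤ-Solver.+-*-Solver

∑<-last : ∀ n (f : ℕ → ℤ) → ∑< (suc n) f ≡ ∑< n f +ℤ f n
∑<-last zero    f = ℤₚ.+-comm (f 0) (+ 0)
∑<-last (suc n) f = trans (cong (f 0 +ℤ_) (∑<-last n (f ∘ suc)))
  (sym (ℤₚ.+-assoc (f 0) (∑< n (f ∘ suc)) (f (suc n))))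

∑<-shift : ∀ n e (Φ : ℕ → ℕ → ℤ) t →
           ∑< n (λ i → shift (+ 0) e (Φ i) t) ≡ shift (+ 0) e (λ t′ → ∑< n (λ i → Φ i t′)) t
∑<-shift n zero    Φ t       = refl
∑<-shift n (suc e) Φ zero    = ∑<-zero n (λ _ → refl)
∑<-shift n (suc e) Φ (suc t) = ∑<-shift n e Φ t

∑<-delay : ∀ n (F : ℕ → ℕ → ℤ) → (∀ i → F i 0 ≡ + 0) →
           ∑< (suc (suc n)) (λ i → F i (suc n ∸ i)) ≡ ∑< (suc n) (λ i → F i (suc (n ∸ i)))
∑<-delay n F F0 = begin
  ∑< (suc (suc n)) (λ i → F i (suc n ∸ i))
    ≡⟨ ∑<-last (suc n) (λ i → F i (suc n ∸ i)) ⟩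
  ∑< (suc n) (λ i → F i (suc n ∸ i)) +ℤ F (suc n) (n ∸ n)
    ≡⟨ cong₂ _+ℤ_ (∑<-cong (suc n) (λ i i≤n → cong (F i) (ℕₚ.+-∸-assoc 1 (ℕₚ.≤-pred i≤n))))
                  (trans (cong (F (suc n)) (ℕₚ.n∸n≡0 n)) (F0 (suc n))) ⟩
  ∑< (suc n) (λ i → F i (suc (n ∸ i))) +ℤ + 0
    ≡⟨ ℤₚ.+-identityʳ _ ⟩
  ∑< (suc n) (λ i → F i (suc (n ∸ i))) ∎
  where open ≡-Reasoning

∑<-antidiagonal : ∀ m (K : ℕ → ℕ → ℤ) → (∀ i k → K i (suc k) ≡ + 0) →
                  ∑< (suc m) (λ i → K i (m ∸ i)) ≡ K m 0
∑<-antidiagonal zero    K K0 = ℤₚ.+-identityʳ (K 0 0)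
∑<-antidiagonal (suc m) K K0 =
  trans (cong₂ _+ℤ_ (K0 0 m) (∑<-antidiagonal m (K ∘ suc) (K0 ∘ suc))) (ℤₚ.+-identityˡ _)

-- Power series in z and q

infix  4 _≈_
infixl 6 _⊕_ _⊖_
infixr 7 zq^_·_ [1-zq^_]·_ poch_·_

_≈_ : Series → Series → Set
f ≈ g = ∀ m N → f m N ≡ g m N

≈-sym : ∀ {f g} → f ≈ g → g ≈ f
≈-sym f≈g m N = sym (f≈g m N)

≈-trans : ∀ {f g h} → f ≈ g → g ≈ h → f ≈ h
≈-trans f≈g g≈h m N = trans (f≈g m N) (g≈h m N)

_⊕_ : Series → Series → Series
(f ⊕ g) m N = f m N +ℤ g m N

_⊖_ : Series → Series → Series
(f ⊖ g) m N = f m N -ℤ g m N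

0ₛ : Series
0ₛ _ _ = + 0

zq^_·_ : ℕ → Series → Series
(zq^ e · f) zero    N = + 0
(zq^ e · f) (suc m) N = shift (+ 0) e (f m) N

[1-zq^_]·_ : ℕ → Series → Series
[1-zq^ e ]· f = f ⊖ zq^ e · f

poch_·_ : ℕ → Series → Series
poch zero    · f = f
poch (suc n) · f = [1-zq^ suc n ]· poch n · f

zq^-cong : ∀ e {f g} → f ≈ g → zq^ e · f ≈ zq^ e · g
zq^-cong e f≈g zero    N = refl
zq^-cong e f≈g (suc m) N = shift-cong e (f≈g m) N

[1-zq^]-cong : ∀ e {f g} → f ≈ g → [1-zq^ e ]· f ≈ [1-zq^ e ]· g
[1-zq^]-cong e f≈g m N = cong₂ _-ℤ_ (f≈g m N) (zq^-cong e f≈g m N)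

poch-cong : ∀ n {f g} → f ≈ g → poch n · f ≈ poch n · g
poch-cong zero    f≈g = f≈g
poch-cong (suc n) f≈g = [1-zq^]-cong (suc n) (poch-cong n f≈g)

zq^-⊕ : ∀ e f g → zq^ e · (f ⊕ g) ≈ zq^ e · f ⊕ zq^ e · g
zq^-⊕ e f g zero    N = refl
zq^-⊕ e f g (suc m) N = shift-zipWith _+ℤ_ refl e (f m) (g m) N

zq^-⊖ : ∀ e f g → zq^ e · (f ⊖ g) ≈ zq^ e · f ⊖ zq^ e · g
zq^-⊖ e f g zero    N = refl
zq^-⊖ e f g (suc m) N = shift-zipWith _-ℤ_ refl e (f m) (g m) N

zq^-comm : ∀ a b f → zq^ a · zq^ b · f ≈ zq^ b · zq^ a · f
zq^-comm a b f zero          N = refl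
zq^-comm a b f (suc zero)    N = trans (shift-vanishing a (λ _ → refl) N) (sym (shift-vanishing b (λ _ → refl) N))
zq^-comm a b f (suc (suc m)) N = begin
  shift (+ 0) a (shift (+ 0) b (f m)) N ≡⟨ shift-shift a b (f m) N ⟩
  shift (+ 0) (a + b) (f m) N           ≡⟨ cong (λ e → shift (+ 0) e (f m) N) (ℕₚ.+-comm a b) ⟩
  shift (+ 0) (b + a) (f m) N           ≡⟨ shift-shift b a (f m) N ⟨
  shift (+ 0) b (shift (+ 0) a (f m)) N ∎
  where open ≡-Reasoning

zq^-[1-zq^] : ∀ a b f → zq^ a · [1-zq^ b ]· f ≈ [1-zq^ b ]· zq^ a · f
zq^-[1-zq^] a b f m N =
  trans (zq^-⊖ a f (zq^ b · f) m N) (cong ((zq^ a · f) m N -ℤ_) (zq^-comm a b f m N))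

[1-zq^]-comm : ∀ a b f → [1-zq^ a ]· [1-zq^ b ]· f ≈ [1-zq^ b ]· [1-zq^ a ]· f
[1-zq^]-comm a b f m N = begin
  (f ⊖ zq^ b · f) m N -ℤ (zq^ a · (f ⊖ zq^ b · f)) m N
    ≡⟨ cong ((f ⊖ zq^ b · f) m N -ℤ_) (zq^-[1-zq^] a b f m N) ⟩
  (f ⊖ zq^ b · f) m N -ℤ (zq^ a · f ⊖ zq^ b · zq^ a · f) m N
    ≡⟨ exchange (f m N) ((zq^ a · f) m N) ((zq^ b · f) m N) ((zq^ b · zq^ a · f) m N) ⟩
  (f ⊖ zq^ a · f) m N -ℤ (zq^ b · f ⊖ zq^ b · zq^ a · f) m N
    ≡⟨ cong ((f ⊖ zq^ a · f) m N -ℤ_) (zq^-⊖ b f (zq^ a · f) m N) ⟨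
  (f ⊖ zq^ a · f) m N -ℤ (zq^ b · (f ⊖ zq^ a · f)) m N ∎
  where
  open ≡-Reasoning
  exchange : ∀ x y z w → (x -ℤ z) -ℤ (y -ℤ w) ≡ (x -ℤ y) -ℤ (z -ℤ w)
  exchange = solve 4 (λ x y z w → (x :- z) :- (y :- w) := (x :- y) :- (z :- w)) refl
    where open ℤ-Solver.+-*-Solver

[1-zq^]-⊕ : ∀ e f g → [1-zq^ e ]· (f ⊕ g) ≈ [1-zq^ e ]· f ⊕ [1-zq^ e ]· g
[1-zq^]-⊕ e f g m N = trans (cong ((f ⊕ g) m N -ℤ_) (zq^-⊕ e f g m N))
  (solve 4 (λ x y z w → (x :+ y) :- (z :+ w) := (x :- z) :+ (y :- w)) refl
     (f m N) (g m N) ((zq^ e · f) m N) ((zq^ e · g) m N))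
  where open ℤ-Solver.+-*-Solver

[1-zq^]-solve : ∀ e {f g} → f ≈ zq^ e · f ⊕ g → [1-zq^ e ]· f ≈ g
[1-zq^]-solve e {f} {g} f≈ m N = trans (cong (_-ℤ (zq^ e · f) m N) (f≈ m N))
  (solve 2 (λ s x → (s :+ x) :- s := x) refl ((zq^ e · f) m N) (g m N))
  where open ℤ-Solver.+-*-Solver

poch-⊕ : ∀ n f g → poch n · (f ⊕ g) ≈ poch n · f ⊕ poch n · g
poch-⊕ zero    f g m N = refl
poch-⊕ (suc n) f g m N =
  trans ([1-zq^]-cong (suc n) (poch-⊕ n f g) m N) ([1-zq^]-⊕ (suc n) (poch n · f) (poch n · g) m N)

poch-comm : (T : Series → Series) → (∀ {f g} → f ≈ g → T f ≈ T g) →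
            (∀ k f → T ([1-zq^ k ]· f) ≈ [1-zq^ k ]· T f) →
            ∀ n f → poch n · T f ≈ T (poch n · f)
poch-comm T T-cong T-[1-zq^] zero    f m N = refl
poch-comm T T-cong T-[1-zq^] (suc n) f m N = trans
  ([1-zq^]-cong (suc n) (poch-comm T T-cong T-[1-zq^] n f) m N)
  (sym (T-[1-zq^] (suc n) (poch n · f) m N))

poch-zq^ : ∀ n e f → poch n · zq^ e · f ≈ zq^ e · poch n · f
poch-zq^ n e = poch-comm (zq^ e ·_) (zq^-cong e) (zq^-[1-zq^] e) n

poch-[1-zq^] : ∀ n e f → poch n · [1-zq^ e ]· f ≈ [1-zq^ e ]· poch n · f
poch-[1-zq^] n e = poch-comm ([1-zq^ e ]·_) ([1-zq^]-cong e) ([1-zq^]-comm e) n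

poch-0ₛ : ∀ n → poch n · 0ₛ ≈ 0ₛ
poch-0ₛ zero    m N = refl
poch-0ₛ (suc n) m N = trans ([1-zq^]-cong (suc n) (poch-0ₛ n) m N) (cong (+ 0 -ℤ_) (zq^-0ₛ m))
  where
  zq^-0ₛ : ∀ m → (zq^ suc n · 0ₛ) m N ≡ + 0
  zq^-0ₛ zero    = refl
  zq^-0ₛ (suc m) = shift-vanishing (suc n) (λ _ → refl) N

recurrence-unique : (F G : ℕ → Series) (e : ℕ → ℕ) → F 0 ≈ G 0 → F 1 ≈ G 1 →
                    (∀ n → F (2 + n) ≈ F (1 + n) ⊕ zq^ e n · F n) →
                    (∀ n → G (2 + n) ≈ G (1 + n) ⊕ zq^ e n · G n) → ∀ n → F n ≈ G n
recurrence-unique F G e F0 F1 Frec Grec = go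
  where
  go : ∀ n → F n ≈ G n
  go zero          = F0
  go (suc zero)    = F1
  go (suc (suc n)) m N = trans (Frec n m N)
    (trans (cong₂ _+ℤ_ (go (suc n) m N) (zq^-cong (e n) (go n) m N)) (sym (Grec n m N)))

infixl 7 _⋆_

_⋆_ : (ℕ → ℤ) → (ℕ → ℤ) → ℕ → ℤ
(A ⋆ B) N = ∑< (suc N) (λ j → A j *ℤ B (N ∸ j))

mul-⋆ : ∀ f g m N → mul f g m N ≡ ∑< (suc m) (λ i → (f i ⋆ g (m ∸ i)) N)
mul-⋆ f g m N =
  trans (Σ≤-∑< m (λ i → Σ≤ N (λ j → f i j *ℤ g (m ∸ i) (N ∸ j))))
        (∑<-cong (suc m) (λ i _ → Σ≤-∑< N (λ j → f i j *ℤ g (m ∸ i) (N ∸ j))))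

⋆-cong : ∀ A {B C} → (∀ t → B t ≡ C t) → ∀ N → (A ⋆ B) N ≡ (A ⋆ C) N
⋆-cong A B≗C N = ∑<-cong (suc N) (λ j _ → cong (A j *ℤ_) (B≗C (N ∸ j)))

⋆-zeroʳ : ∀ A {B} → (∀ t → B t ≡ + 0) → ∀ N → (A ⋆ B) N ≡ + 0
⋆-zeroʳ A B≗0 N = ∑<-zero (suc N) (λ j → trans (cong (A j *ℤ_) (B≗0 (N ∸ j))) (ℤₚ.*-zeroʳ (A j)))

⋆-−ʳ : ∀ A B C N → (A ⋆ (λ t → B t -ℤ C t)) N ≡ (A ⋆ B) N -ℤ (A ⋆ C) N
⋆-−ʳ A B C N = trans
  (∑<-cong (suc N) (λ j _ → distrib (A j) (B (N ∸ j)) (C (N ∸ j))))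
  (∑<-− (suc N) (λ j → A j *ℤ B (N ∸ j)) (λ j → A j *ℤ C (N ∸ j)))
  where
  distrib : ∀ a b c → a *ℤ (b -ℤ c) ≡ a *ℤ b -ℤ a *ℤ c
  distrib = solve 3 (λ a b c → a :* (b :- c) := a :* b :- a :* c) refl
    where open ℤ-Solver.+-*-Solver

⋆-shift : ∀ e A B N → (A ⋆ shift (+ 0) e B) N ≡ shift (+ 0) e (A ⋆ B) N
⋆-shift zero    A B N       = refl
⋆-shift (suc e) A B zero    = cong (_+ℤ + 0) (ℤₚ.*-zeroʳ (A 0))
⋆-shift (suc e) A B (suc N) =
  trans (∑<-delay N (λ j k → A j *ℤ shift (+ 0) (suc e) B k) (λ j → ℤₚ.*-zeroʳ (A j))) (⋆-shift e A B N)

mul-congʳ : ∀ f {g h} → g ≈ h → mul f g ≈ mul f h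
mul-congʳ f {g} {h} g≈h m N = begin
  mul f g m N                            ≡⟨ mul-⋆ f g m N ⟩
  ∑< (suc m) (λ i → (f i ⋆ g (m ∸ i)) N) ≡⟨ ∑<-cong (suc m) (λ i _ → ⋆-cong (f i) (g≈h (m ∸ i)) N) ⟩
  ∑< (suc m) (λ i → (f i ⋆ h (m ∸ i)) N) ≡⟨ mul-⋆ f h m N ⟨
  mul f h m N                            ∎
  where open ≡-Reasoning

mul-⊖ʳ : ∀ f g h → mul f (g ⊖ h) ≈ mul f g ⊖ mul f h
mul-⊖ʳ f g h m N = begin
  mul f (g ⊖ h) m N
    ≡⟨ mul-⋆ f (g ⊖ h) m N ⟩
  ∑< (suc m) (λ i → (f i ⋆ (λ t → g (m ∸ i) t -ℤ h (m ∸ i) t)) N)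
    ≡⟨ ∑<-cong (suc m) (λ i _ → ⋆-−ʳ (f i) (g (m ∸ i)) (h (m ∸ i)) N) ⟩
  ∑< (suc m) (λ i → (f i ⋆ g (m ∸ i)) N -ℤ (f i ⋆ h (m ∸ i)) N)
    ≡⟨ ∑<-− (suc m) (λ i → (f i ⋆ g (m ∸ i)) N) (λ i → (f i ⋆ h (m ∸ i)) N) ⟩
  ∑< (suc m) (λ i → (f i ⋆ g (m ∸ i)) N) -ℤ ∑< (suc m) (λ i → (f i ⋆ h (m ∸ i)) N)
    ≡⟨ cong₂ _-ℤ_ (mul-⋆ f g m N) (mul-⋆ f h m N) ⟨
  mul f g m N -ℤ mul f h m N ∎
  where open ≡-Reasoning

mul-oneʳ : ∀ f → mul f one ≈ f
mul-oneʳ f m N = begin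
  mul f one m N
    ≡⟨ mul-⋆ f one m N ⟩
  ∑< (suc m) (λ i → (f i ⋆ one (m ∸ i)) N)
    ≡⟨ ∑<-antidiagonal m (λ i k → (f i ⋆ one k) N) (λ i k → ⋆-zeroʳ (f i) (λ _ → refl) N) ⟩
  (f m ⋆ one 0) N
    ≡⟨ ∑<-antidiagonal N (λ j k → f m j *ℤ one 0 k) (λ j k → ℤₚ.*-zeroʳ (f m j)) ⟩
  f m N *ℤ + 1
    ≡⟨ ℤₚ.*-identityʳ (f m N) ⟩
  f m N ∎
  where open ≡-Reasoning

mul-zq^ʳ : ∀ e f g → mul f (zq^ e · g) ≈ zq^ e · mul f g
mul-zq^ʳ e f g zero    N = trans (mul-⋆ f (zq^ e · g) 0 N) (trans (ℤₚ.+-identityʳ _) (⋆-zeroʳ (f 0) (λ _ → refl) N))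
mul-zq^ʳ e f g (suc m) N = begin
  mul f (zq^ e · g) (suc m) N
    ≡⟨ mul-⋆ f (zq^ e · g) (suc m) N ⟩
  ∑< (suc (suc m)) (λ i → (f i ⋆ (zq^ e · g) (suc m ∸ i)) N)
    ≡⟨ ∑<-delay m (λ i k → (f i ⋆ (zq^ e · g) k) N) (λ i → ⋆-zeroʳ (f i) (λ _ → refl) N) ⟩
  ∑< (suc m) (λ i → (f i ⋆ shift (+ 0) e (g (m ∸ i))) N)
    ≡⟨ ∑<-cong (suc m) (λ i _ → ⋆-shift e (f i) (g (m ∸ i)) N) ⟩
  ∑< (suc m) (λ i → shift (+ 0) e (f i ⋆ g (m ∸ i)) N)
    ≡⟨ ∑<-shift (suc m) e (λ i → f i ⋆ g (m ∸ i)) N ⟩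
  shift (+ 0) e (λ t → ∑< (suc m) (λ i → (f i ⋆ g (m ∸ i)) t)) N
    ≡⟨ shift-cong e (λ t → mul-⋆ f g m t) N ⟨
  (zq^ e · mul f g) (suc m) N ∎
  where open ≡-Reasoning

oneMinusZQ≈[1-zq^]·one : ∀ e → oneMinusZQ e ≈ [1-zq^ e ]· one
oneMinusZQ≈[1-zq^]·one e zero          zero    = refl
oneMinusZQ≈[1-zq^]·one e zero          (suc t) = refl
oneMinusZQ≈[1-zq^]·one e (suc zero)    t       = sym (trans
  (cong (+ 0 -ℤ_) (shift-one e t)) (negate (t ≡ᵇ e)))
  where
  shift-one : ∀ e t → shift (+ 0) e (one 0) t ≡ (if t ≡ᵇ e then + 1 else + 0)
  shift-one zero    zero    = refl
  shift-one zero    (suc t) = refl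
  shift-one (suc e) zero    = refl
  shift-one (suc e) (suc t) = shift-one e t
  negate : ∀ b → + 0 -ℤ (if b then + 1 else + 0) ≡ (if b then - + 1 else + 0)
  negate true  = refl
  negate false = refl
oneMinusZQ≈[1-zq^]·one e (suc (suc i)) t = sym (cong (+ 0 -ℤ_) (shift-vanishing e (λ _ → refl) t))

mul-[1-zq^]ʳ : ∀ e f g → mul f ([1-zq^ e ]· g) ≈ [1-zq^ e ]· mul f g
mul-[1-zq^]ʳ e f g m N =
  trans (mul-⊖ʳ f g (zq^ e · g) m N) (cong (mul f g m N -ℤ_) (mul-zq^ʳ e f g m N))

mul-oneMinusZQʳ : ∀ e f → mul f (oneMinusZQ e) ≈ [1-zq^ e ]· f
mul-oneMinusZQʳ e f m N = begin
  mul f (oneMinusZQ e) m N         ≡⟨ mul-congʳ f (oneMinusZQ≈[1-zq^]·one e) m N ⟩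
  mul f ([1-zq^ e ]· one) m N      ≡⟨ mul-[1-zq^]ʳ e f one m N ⟩
  ([1-zq^ e ]· mul f one) m N      ≡⟨ [1-zq^]-cong e (mul-oneʳ f) m N ⟩
  ([1-zq^ e ]· f) m N              ∎
  where open ≡-Reasoning

mul-pochZQʳ : ∀ n f → mul f (pochZQ n) ≈ poch n · f
mul-pochZQʳ zero    f = mul-oneʳ f
mul-pochZQʳ (suc n) f m N = begin
  mul f (mul (pochZQ n) (oneMinusZQ (suc n))) m N
    ≡⟨ mul-congʳ f (mul-oneMinusZQʳ (suc n) (pochZQ n)) m N ⟩
  mul f ([1-zq^ suc n ]· pochZQ n) m N
    ≡⟨ mul-[1-zq^]ʳ (suc n) f (pochZQ n) m N ⟩
  ([1-zq^ suc n ]· mul f (pochZQ n)) m N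
    ≡⟨ [1-zq^]-cong (suc n) (mul-pochZQʳ n f) m N ⟩
  (poch suc n · f) m N ∎
  where open ≡-Reasoning

-- Gaussian binomials

qbin-empty : ∀ p j t → p < j → qbin p j t ≡ 0
qbin-empty zero    (suc j) t _         = refl
qbin-empty (suc p) (suc j) t (s≤s p<j) = cong₂ _+_ (qbin-empty p j t p<j) (trans
  (shift-if (suc j) (qbin p (suc j)) t)
  (shift-vanishing (suc j) (λ t′ → qbin-empty p (suc j) t′ (ℕₚ.m<n⇒m<1+n p<j)) t))

qbin-pascal : ∀ n m t → qbin (suc n) (suc m) t ≡ qbin n m t + shift 0 (suc m) (qbin n (suc m)) t
qbin-pascal n m t = cong (λ s → qbin n m t + s) (shift-if (suc m) (qbin n (suc m)) t)

shift-qbin-exponent : ∀ {e e′} p j t → (j ≤ p → e ≡ e′) →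
                      shift 0 e (qbin p j) t ≡ shift 0 e′ (qbin p j) t
shift-qbin-exponent {e} {e′} p j t e≡e′ with j ℕₚ.≤? p
... | yes j≤p = cong (λ k → shift 0 k (qbin p j) t) (e≡e′ j≤p)
... | no  j≰p = trans (shift-vanishing e vanish t) (sym (shift-vanishing e′ vanish t))
  where
  vanish : ∀ t → qbin p j t ≡ 0
  vanish t = qbin-empty p j t (ℕₚ.≰⇒> j≰p)

qbin-pascal-dual : ∀ p j t → qbin (suc p) (suc j) t ≡ shift 0 (p ∸ j) (qbin p j) t + qbin p (suc j) t
qbin-pascal-dual zero zero t =
  trans (qbin-pascal 0 0 t) (cong (λ s → qbin 0 0 t + s) (shift-vanishing 1 (λ _ → refl) t))
qbin-pascal-dual zero (suc j) t =
  trans (qbin-pascal 0 (suc j) t) (cong (λ s → qbin 0 (suc j) t + s) (shift-vanishing (suc (suc j)) (λ _ → refl) t))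
qbin-pascal-dual (suc p) zero t = begin
  qbin (suc (suc p)) 1 t
    ≡⟨ qbin-pascal (suc p) 0 t ⟩
  qbin p 0 t + shift 0 1 (qbin (suc p) 1) t
    ≡⟨ cong (λ s → qbin p 0 t + s) (shift-cong 1 (qbin-pascal-dual p 0) t) ⟩
  qbin p 0 t + shift 0 1 (λ k → shift 0 p (qbin p 0) k + qbin p 1 k) t
    ≡⟨ cong (λ s → qbin p 0 t + s) (shift-zipWith _+_ refl 1 (shift 0 p (qbin p 0)) (qbin p 1) t) ⟩
  qbin p 0 t + (shift 0 1 (shift 0 p (qbin p 0)) t + shift 0 1 (qbin p 1) t)
    ≡⟨ cong (λ s → qbin p 0 t + (s + shift 0 1 (qbin p 1) t)) (shift-shift 1 p (qbin p 0) t) ⟩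
  qbin p 0 t + (shift 0 (suc p) (qbin p 0) t + shift 0 1 (qbin p 1) t)
    ≡⟨ x∙yz≈y∙xz (qbin p 0 t) (shift 0 (suc p) (qbin p 0) t) _ ⟩
  shift 0 (suc p) (qbin p 0) t + (qbin p 0 t + shift 0 1 (qbin p 1) t)
    ≡⟨ cong (λ s → shift 0 (suc p) (qbin p 0) t + s) (qbin-pascal p 0 t) ⟨
  shift 0 (suc p) (qbin (suc p) 0) t + qbin (suc p) 1 t ∎
  where open ≡-Reasoning
qbin-pascal-dual (suc p) (suc j) t = begin
  qbin (suc (suc p)) (suc (suc j)) t
    ≡⟨ qbin-pascal (suc p) (suc j) t ⟩
  qbin (suc p) (suc j) t + shift 0 (suc (suc j)) (qbin (suc p) (suc (suc j))) t
    ≡⟨ cong₂ _+_ (qbin-pascal-dual p j t) (shift-cong (suc (suc j)) (qbin-pascal-dual p (suc j)) t) ⟩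
  (A + B t) + shift 0 (suc (suc j)) (λ k → shift 0 (p ∸ suc j) B k + qbin p (suc (suc j)) k) t
    ≡⟨ cong (λ s → (A + B t) + s) (shift-zipWith _+_ refl (suc (suc j)) (shift 0 (p ∸ suc j) B) (qbin p (suc (suc j))) t) ⟩
  (A + B t) + (shift 0 (suc (suc j)) (shift 0 (p ∸ suc j) B) t + C)
    ≡⟨ cong (λ s → (A + B t) + (s + C)) exponents ⟩
  (A + B t) + (shift 0 (p ∸ j) (shift 0 (suc j) B) t + C)
    ≡⟨ interchange A (B t) _ C ⟩
  (A + shift 0 (p ∸ j) (shift 0 (suc j) B) t) + (B t + C)
    ≡⟨ cong₂ _+_ (sym (trans (shift-cong (p ∸ j) (qbin-pascal p j) t)
                            (shift-zipWith _+_ refl (p ∸ j) (qbin p j) (shift 0 (suc j) B) t)))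
                 (sym (qbin-pascal p (suc j) t)) ⟩
  shift 0 (p ∸ j) (qbin (suc p) (suc j)) t + qbin (suc p) (suc (suc j)) t ∎
  where
  open ≡-Reasoning
  A = shift 0 (p ∸ j) (qbin p j) t
  B = qbin p (suc j)
  C = shift 0 (suc (suc j)) (qbin p (suc (suc j))) t
  exponents : shift 0 (suc (suc j)) (shift 0 (p ∸ suc j) B) t ≡ shift 0 (p ∸ j) (shift 0 (suc j) B) t
  exponents = begin
    shift 0 (suc (suc j)) (shift 0 (p ∸ suc j) B) t ≡⟨ shift-shift (suc (suc j)) (p ∸ suc j) B t ⟩
    shift 0 (suc (suc j) + (p ∸ suc j)) B t         ≡⟨ shift-qbin-exponent p (suc j) t arith ⟩
    shift 0 ((p ∸ j) + suc j) B t                   ≡⟨ shift-shift (p ∸ j) (suc j) B t ⟨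
    shift 0 (p ∸ j) (shift 0 (suc j) B) t           ∎
    where
    arith : suc j ≤ p → suc (suc j) + (p ∸ suc j) ≡ (p ∸ j) + suc j
    arith sj≤p = begin
      suc (suc j) + (p ∸ suc j) ≡⟨ cong suc (ℕₚ.m+[n∸m]≡n sj≤p) ⟩
      suc p                      ≡⟨ cong suc (ℕₚ.m∸n+n≡m (ℕₚ.<⇒≤ sj≤p)) ⟨
      suc ((p ∸ j) + j)          ≡⟨ ℕₚ.+-suc (p ∸ j) j ⟨
      (p ∸ j) + suc j            ∎

binomialSum : ℕ → ℕ → Series
binomialSum a N m t = if m * (m + a) ≤ᵇ t then + qbin (N ∸ m) m (t ∸ m * (m + a)) else + 0

binomialSum-shift : ∀ a N m t → binomialSum a N m t ≡ + shift 0 (m * (m + a)) (qbin (N ∸ m) m) t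
binomialSum-shift a N m t = trans
  (shift-if (m * (m + a)) (λ k → + qbin (N ∸ m) m k) t)
  (shift-map +_ refl (m * (m + a)) (qbin (N ∸ m) m) t)

binomialSum-initial : ∀ a N → N ≤ 1 → binomialSum a N ≈ one
binomialSum-initial a N N≤1 zero    zero    = refl
binomialSum-initial a N N≤1 zero    (suc t) = refl
binomialSum-initial a N N≤1 (suc j) t       = trans (binomialSum-shift a N (suc j) t)
  (cong +_ (shift-vanishing (suc j * (suc j + a)) (λ k → qbin-empty (N ∸ suc j) (suc j) k (small N≤1)) t))
  where
  small : ∀ {N} → N ≤ 1 → N ∸ suc j < suc j
  small {zero}  _         = s≤s z≤n
  small {suc zero} _      = s≤s (ℕₚ.≤-trans (ℕₚ.≤-reflexive (ℕₚ.0∸n≡0 j)) z≤n)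
  small {suc (suc N)} (s≤s ())

binomialSum-exponent : ∀ a N j → j ≤ N → j ≤ N ∸ j → suc j * (suc j + a) + ((N ∸ j) ∸ j) ≡ a + suc N + j * (j + a)
binomialSum-exponent a N j j≤N j≤N∸j = begin
  suc j * (suc j + a) + u           ≡⟨ solve 3 (λ u j a → (con 1 :+ j) :* ((con 1 :+ j) :+ a) :+ u
                                                 := a :+ (con 1 :+ ((u :+ j) :+ j)) :+ j :* (j :+ a)) refl u j a ⟩
  a + suc (u + j + j) + j * (j + a) ≡⟨ cong (λ n → a + suc n + j * (j + a)) u+j+j≡N ⟩
  a + suc N + j * (j + a)           ∎
  where
  open ≡-Reasoning
  open ℕ-Solver.+-*-Solver using (solve; _:+_; _:*_; _:=_; con)
  u = (N ∸ j) ∸ j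
  u+j+j≡N : u + j + j ≡ N
  u+j+j≡N = trans (cong (_+ j) (ℕₚ.m∸n+n≡m j≤N∸j)) (ℕₚ.m∸n+n≡m j≤N)

binomialSum-rec-coefficient : ∀ a N j t →
  shift 0 (suc j * (suc j + a)) (qbin (suc N ∸ j) (suc j)) t ≡
  shift 0 (suc j * (suc j + a)) (qbin (N ∸ j) (suc j)) t + shift 0 (a + suc N + j * (j + a)) (qbin (N ∸ j) j) t
binomialSum-rec-coefficient a N j t with j ℕₚ.≤? N
... | no j≰N = trans (vanish (suc j * (suc j + a)) (suc N ∸ j) (suc j) (s≤s (ℕₚ.≤-trans (ℕₚ.m∸n≤m (suc N) j) N<j)))
  (sym (cong₂ _+_ (vanish (suc j * (suc j + a)) (N ∸ j) (suc j) (ℕₚ.m<n⇒m<1+n N∸j<j))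
                  (vanish (a + suc N + j * (j + a)) (N ∸ j) j N∸j<j)))
  where
  N<j : N < j
  N<j = ℕₚ.≰⇒> j≰N
  N∸j<j : N ∸ j < j
  N∸j<j = ℕₚ.≤-<-trans (ℕₚ.m∸n≤m N j) N<j
  vanish : ∀ e p i → p < i → shift 0 e (qbin p i) t ≡ 0
  vanish e p i p<i = shift-vanishing e (λ k → qbin-empty p i k p<i) t
... | yes j≤N = begin
  shift 0 E (qbin (suc N ∸ j) (suc j)) t
    ≡⟨ shift-cong E (λ k → cong (λ p → qbin p (suc j) k) (ℕₚ.+-∸-assoc 1 j≤N)) t ⟩
  shift 0 E (qbin (suc (N ∸ j)) (suc j)) t
    ≡⟨ shift-cong E (qbin-pascal-dual (N ∸ j) j) t ⟩
  shift 0 E (λ k → shift 0 ((N ∸ j) ∸ j) B k + C k) t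
    ≡⟨ shift-zipWith _+_ refl E (shift 0 ((N ∸ j) ∸ j) B) C t ⟩
  shift 0 E (shift 0 ((N ∸ j) ∸ j) B) t + shift 0 E C t
    ≡⟨ cong (_+ shift 0 E C t) (shift-shift E ((N ∸ j) ∸ j) B t) ⟩
  shift 0 (E + ((N ∸ j) ∸ j)) B t + shift 0 E C t
    ≡⟨ cong (_+ shift 0 E C t) (shift-qbin-exponent (N ∸ j) j t (binomialSum-exponent a N j j≤N)) ⟩
  shift 0 (a + suc N + j * (j + a)) B t + shift 0 E C t
    ≡⟨ ℕₚ.+-comm (shift 0 (a + suc N + j * (j + a)) B t) (shift 0 E C t) ⟩
  shift 0 E C t + shift 0 (a + suc N + j * (j + a)) B t ∎
  where
  open ≡-Reasoning
  E = suc j * (suc j + a)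
  B = qbin (N ∸ j) j
  C = qbin (N ∸ j) (suc j)

binomialSum-rec : ∀ a N → binomialSum a (suc (suc N)) ≈ binomialSum a (suc N) ⊕ zq^ (a + suc N) · binomialSum a N
binomialSum-rec a N zero    t = sym (ℤₚ.+-identityʳ _)
binomialSum-rec a N (suc j) t = begin
  binomialSum a (suc (suc N)) (suc j) t
    ≡⟨ binomialSum-shift a (suc (suc N)) (suc j) t ⟩
  + shift 0 (suc j * (suc j + a)) (qbin (suc N ∸ j) (suc j)) t
    ≡⟨ cong +_ (binomialSum-rec-coefficient a N j t) ⟩
  + shift 0 (suc j * (suc j + a)) (qbin (N ∸ j) (suc j)) t +ℤ + shift 0 (a + suc N + j * (j + a)) (qbin (N ∸ j) j) t
    ≡⟨ cong₂ _+ℤ_ (binomialSum-shift a (suc N) (suc j) t) lower ⟨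
  binomialSum a (suc N) (suc j) t +ℤ shift (+ 0) (a + suc N) (binomialSum a N j) t ∎
  where
  open ≡-Reasoning
  lower : shift (+ 0) (a + suc N) (binomialSum a N j) t ≡ + shift 0 (a + suc N + j * (j + a)) (qbin (N ∸ j) j) t
  lower = begin
    shift (+ 0) (a + suc N) (binomialSum a N j) t
      ≡⟨ shift-cong (a + suc N) (binomialSum-shift a N j) t ⟩
    shift (+ 0) (a + suc N) (λ k → + shift 0 (j * (j + a)) (qbin (N ∸ j) j) k) t
      ≡⟨ shift-map +_ refl (a + suc N) (shift 0 (j * (j + a)) (qbin (N ∸ j) j)) t ⟩
    + shift 0 (a + suc N) (shift 0 (j * (j + a)) (qbin (N ∸ j) j)) t
      ≡⟨ cong +_ (shift-shift (a + suc N) (j * (j + a)) (qbin (N ∸ j) j) t) ⟩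
    + shift 0 (a + suc N + j * (j + a)) (qbin (N ∸ j) j) t ∎

-- Fences

-- Entries beyond the end of a list read as 0, so the fence conditions near the end are vacuous.
infixl 9 _!_
_!_ : List ℕ → ℕ → ℕ
_!_ = get 0

record Fence (x : List ℕ) : Set where
  constructor mkFence
  field
    descends : ∀ i → x ! (2 + i) ≤ x ! i × x ! (3 + i) ≤ x ! i
open Fence

HeadDescent : ℕ → List ℕ → Set
HeadDescent zero    x = ⊤
HeadDescent (suc a) x = x ! 1 ≤ x ! 0

listMax : List ℕ → ℕ
listMax = foldr _⊔_ 0

record IsFence (a n : ℕ) (x : List ℕ) : Set where
  constructor mkIsFence
  field
    length≡ : length x ≡ n
    fence   : Fence x
    head    : HeadDescent a x

record FenceWith (a n m N : ℕ) (x : List ℕ) : Set where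
  constructor fenceWith
  field
    isFence : IsFence a n x
    max≡    : listMax x ≡ m
    sum≡    : sum x ≡ N

!-beyond : ∀ x {j} → length x ≤ j → x ! j ≡ 0
!-beyond []      _         = refl
!-beyond (h ∷ x) (s≤s x≤j) = !-beyond x x≤j

!-beyond-≤ : ∀ x {j v} → length x ≤ j → x ! j ≤ v
!-beyond-≤ x x≤j = subst (_≤ _) (sym (!-beyond x x≤j)) z≤n

!-++ˡ : ∀ x y {j} → j < length x → (x ++ y) ! j ≡ x ! j
!-++ˡ (h ∷ x) y {zero}  _         = refl
!-++ˡ (h ∷ x) y {suc j} (s≤s j<x) = !-++ˡ x y j<x

!-++ʳ : ∀ x y j → (x ++ y) ! (j + length x) ≡ y ! j
!-++ʳ x y j = subst (λ k → (x ++ y) ! k ≡ y ! j) (ℕₚ.+-comm (length x) j) (skip x)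
  where
  skip : ∀ x → (x ++ y) ! (length x + j) ≡ y ! j
  skip []      = refl
  skip (h ∷ x) = skip x

!-∷ʳ0 : ∀ x j → (x ∷ʳ 0) ! j ≡ x ! j
!-∷ʳ0 []      zero    = refl
!-∷ʳ0 []      (suc j) = refl
!-∷ʳ0 (h ∷ x) zero    = refl
!-∷ʳ0 (h ∷ x) (suc j) = !-∷ʳ0 x j

!-map-< : ∀ f x {j} → j < length x → map f x ! j ≡ f (x ! j)
!-map-< f (h ∷ x) {zero}  _         = refl
!-map-< f (h ∷ x) {suc j} (s≤s j<x) = !-map-< f x j<x

Monotone : (ℕ → ℕ) → Set
Monotone f = ∀ {u v} → u ≤ v → f u ≤ f v

!-map-mono : ∀ {f} → Monotone f → ∀ x {i j} → i ≤ j → x ! j ≤ x ! i → map f x ! j ≤ map f x ! i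
!-map-mono f-mono []      _         _ = z≤n
!-map-mono f-mono (h ∷ x) {zero}  {zero}  _         _ = ℕₚ.≤-refl
!-map-mono f-mono (h ∷ x) {zero}  {suc j} _         xj≤h
  with j ℕₚ.<? length x
... | yes j<x = ℕₚ.≤-trans (ℕₚ.≤-reflexive (!-map-< _ x j<x)) (f-mono xj≤h)
... | no  j≮x = !-beyond-≤ (map _ x) (subst (_≤ j) (sym (length-map _ x)) (ℕₚ.≮⇒≥ j≮x))
!-map-mono f-mono (h ∷ x) {suc i} {suc j} (s≤s i≤j) xj≤xi = !-map-mono f-mono x i≤j xj≤xi

!-≤-listMax : ∀ x j → x ! j ≤ listMax x
!-≤-listMax []      j       = z≤n
!-≤-listMax (h ∷ x) zero    = ℕₚ.m≤m⊔n h (listMax x)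
!-≤-listMax (h ∷ x) (suc j) = ℕₚ.≤-trans (!-≤-listMax x j) (ℕₚ.m≤n⊔m h (listMax x))

++-view : ∀ k x {l} → length x ≡ k + l → Σ[ y ∈ List ℕ ] Σ[ z ∈ List ℕ ] x ≡ y ++ z × length y ≡ k × length z ≡ l
++-view zero    x       lx = [] , x , refl , refl , lx
++-view (suc k) (h ∷ x) lx with ++-view k x (ℕₚ.suc-injective lx)
... | y , z , refl , ly , lz = h ∷ y , z , refl , cong suc ly , lz

length-∷ʳ : {A : Set} (x : List A) (v : A) → length (x ∷ʳ v) ≡ suc (length x)
length-∷ʳ x v = trans (length-++ x) (ℕₚ.+-comm (length x) 1)

listMax-++ : ∀ x y → listMax (x ++ y) ≡ listMax x ⊔ listMax y
listMax-++ []      y = refl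
listMax-++ (h ∷ x) y = trans (cong (h ⊔_) (listMax-++ x y)) (sym (ℕₚ.⊔-assoc h (listMax x) (listMax y)))

listMax-∷ʳ0 : ∀ y → listMax (y ∷ʳ 0) ≡ listMax y
listMax-∷ʳ0 y = trans (listMax-++ y (0 ∷ [])) (ℕₚ.⊔-identityʳ (listMax y))

sum-∷ʳ0 : ∀ y → sum (y ∷ʳ 0) ≡ sum y
sum-∷ʳ0 y = trans (sum-++ y (0 ∷ [])) (ℕₚ.+-identityʳ (sum y))

raise lower : ℕ → List ℕ → List ℕ
raise c = map (_+_ c)
lower c = map (_∸ c)

raise-lower : ∀ c x → (∀ j → j < length x → c ≤ x ! j) → raise c (lower c x) ≡ x
raise-lower c []      _    = refl
raise-lower c (h ∷ x) c≤x =
  cong₂ _∷_ (ℕₚ.m+[n∸m]≡n (c≤x 0 (s≤s z≤n))) (raise-lower c x (λ j j<x → c≤x (suc j) (s≤s j<x)))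

lower-raise : ∀ c x → lower c (raise c x) ≡ x
lower-raise c []      = refl
lower-raise c (h ∷ x) = cong₂ _∷_ (ℕₚ.m+n∸m≡n c h) (lower-raise c x)

listMax-raise : ∀ c x → listMax (raise c x) ⊔ c ≡ c + listMax x
listMax-raise c []      = sym (ℕₚ.+-identityʳ c)
listMax-raise c (h ∷ x) = begin
  ((c + h) ⊔ listMax (raise c x)) ⊔ c   ≡⟨ ℕₚ.⊔-assoc (c + h) _ c ⟩
  (c + h) ⊔ (listMax (raise c x) ⊔ c)   ≡⟨ cong ((c + h) ⊔_) (listMax-raise c x) ⟩
  (c + h) ⊔ (c + listMax x)             ≡⟨ ℕₚ.+-distribˡ-⊔ c h (listMax x) ⟨
  c + (h ⊔ listMax x)                   ∎
  where open ≡-Reasoning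

listMax-raise-∷ : ∀ c h y → listMax (raise c (h ∷ y)) ≡ c + listMax (h ∷ y)
listMax-raise-∷ c h y = trans (sym (ℕₚ.m≥n⇒m⊔n≡m c≤max)) (listMax-raise c (h ∷ y))
  where
  c≤max : c ≤ listMax (raise c (h ∷ y))
  c≤max = ℕₚ.≤-trans (ℕₚ.m≤m+n c h) (ℕₚ.m≤m⊔n (c + h) (listMax (raise c y)))

sum-raise : ∀ c x → sum (raise c x) ≡ c * length x + sum x
sum-raise c []      = sym (trans (ℕₚ.+-identityʳ (c * 0)) (ℕₚ.*-zeroʳ c))
sum-raise c (h ∷ x) = trans (cong (_+_ (c + h)) (sum-raise c x))
  (solve 4 (λ c h l s → (c :+ h) :+ (c :* l :+ s) := c :* (con 1 :+ l) :+ (h :+ s)) refl c h (length x) (sum x))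
  where open ℕ-Solver.+-*-Solver using (solve; _:+_; _:*_; _:=_; con)

fence-≤ : ∀ {x} → Fence x → ∀ {i j} → 2 + i ≤ j → x ! j ≤ x ! i
fence-≤ {x} fx {i} {j} 2+i≤j = subst (λ k → x ! k ≤ x ! i) j≡ (gap (j ∸ (2 + i)) i)
  where
  gap : ∀ d i → x ! (2 + (d + i)) ≤ x ! i
  gap zero          i = proj₁ (descends fx i)
  gap (suc zero)    i = proj₂ (descends fx i)
  gap (suc (suc d)) i = ℕₚ.≤-trans
    (subst (λ k → x ! (2 + k) ≤ x ! (2 + i)) (x∙yz≈y∙xz d 2 i) (gap d (2 + i)))
    (proj₁ (descends fx i))
  j≡ : 2 + ((j ∸ (2 + i)) + i) ≡ j
  j≡ = trans (sym (x∙yz≈y∙xz (j ∸ (2 + i)) 2 i)) (ℕₚ.m∸n+n≡m 2+i≤j)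

fence-from-≤ : ∀ {x} → (∀ {i j} → 2 + i ≤ j → x ! j ≤ x ! i) → Fence x
fence-from-≤ below = mkFence (λ i → below ℕₚ.≤-refl , below (ℕₚ.n≤1+n (2 + i)))

fence-cong : ∀ x y → (∀ j → x ! j ≡ y ! j) → Fence x → Fence y
fence-cong x y x≗y fx = mkFence λ i →
  subst₂ _≤_ (x≗y (2 + i)) (x≗y i) (proj₁ (descends fx i)) , subst₂ _≤_ (x≗y (3 + i)) (x≗y i) (proj₂ (descends fx i))

head-cong : ∀ a x y → (∀ j → x ! j ≡ y ! j) → HeadDescent a x → HeadDescent a y
head-cong zero    x y x≗y _  = tt
head-cong (suc a) x y x≗y hx = subst₂ _≤_ (x≗y 1) (x≗y 0) hx

fence-map : ∀ {f} → Monotone f → ∀ x → Fence x → Fence (map f x)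
fence-map f-mono x fx = mkFence λ i →
  !-map-mono f-mono x (ℕₚ.m≤n+m i 2) (proj₁ (descends fx i)) , !-map-mono f-mono x (ℕₚ.m≤n+m i 3) (proj₂ (descends fx i))

head-map : ∀ a {f} → Monotone f → ∀ x → HeadDescent a x → HeadDescent a (map f x)
head-map zero    f-mono x _  = tt
head-map (suc a) f-mono x hx = !-map-mono f-mono x z≤n hx

IsFence-∷ʳ0⁺ : ∀ {a n y} → IsFence a n y → IsFence a (suc n) (y ∷ʳ 0)
IsFence-∷ʳ0⁺ {a} {y = y} (mkIsFence ly fy hy) = mkIsFence (trans (length-∷ʳ y 0) (cong suc ly))
  (fence-cong y (y ∷ʳ 0) (λ j → sym (!-∷ʳ0 y j)) fy) (head-cong a y (y ∷ʳ 0) (λ j → sym (!-∷ʳ0 y j)) hy)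

IsFence-∷ʳ0⁻ : ∀ {a n y} → IsFence a (suc n) (y ∷ʳ 0) → IsFence a n y
IsFence-∷ʳ0⁻ {a} {y = y} (mkIsFence ly fy hy) = mkIsFence (ℕₚ.suc-injective (trans (sym (length-∷ʳ y 0)) ly))
  (fence-cong (y ∷ʳ 0) y (!-∷ʳ0 y) fy) (head-cong a (y ∷ʳ 0) y (!-∷ʳ0 y) hy)

IsFence-raise⁺ : ∀ {a n} c {y} → IsFence a n y → IsFence a n (raise c y)
IsFence-raise⁺ {a} c {y} (mkIsFence ly fy hy) = mkIsFence (trans (length-map _ y) ly)
  (fence-map (ℕₚ.+-monoʳ-≤ c) y fy) (head-map a (ℕₚ.+-monoʳ-≤ c) y hy)

IsFence-raise⁻ : ∀ {a n} c {y} → IsFence a n (raise c y) → IsFence a n y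
IsFence-raise⁻ {a} c {y} (mkIsFence ly fy hy) = mkIsFence (trans (sym (length-map _ y)) ly)
  (subst Fence (lower-raise c y) (fence-map (ℕₚ.∸-monoˡ-≤ c) (raise c y) fy))
  (subst (HeadDescent a) (lower-raise c y) (head-map a (ℕₚ.∸-monoˡ-≤ c) (raise c y) hy))

dipped : ℕ → List ℕ → List ℕ
dipped c y = raise c y ++ 0 ∷ c ∷ []

length-dipped : ∀ c y → length (dipped c y) ≡ 2 + length y
length-dipped c y = trans (length-++ (raise c y)) (trans (cong (_+ 2) (length-map _ y)) (ℕₚ.+-comm (length y) 2))

listMax-dipped : ∀ c y → listMax (dipped c y) ≡ c + listMax y
listMax-dipped c y = begin
  listMax (raise c y ++ 0 ∷ c ∷ [])  ≡⟨ listMax-++ (raise c y) (0 ∷ c ∷ []) ⟩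
  listMax (raise c y) ⊔ (c ⊔ 0)      ≡⟨ cong (listMax (raise c y) ⊔_) (ℕₚ.⊔-identityʳ c) ⟩
  listMax (raise c y) ⊔ c            ≡⟨ listMax-raise c y ⟩
  c + listMax y                      ∎
  where open ≡-Reasoning

sum-dipped : ∀ c y → sum (dipped c y) ≡ c * suc (length y) + sum y
sum-dipped c y = begin
  sum (raise c y ++ 0 ∷ c ∷ [])  ≡⟨ sum-++ (raise c y) (0 ∷ c ∷ []) ⟩
  sum (raise c y) + (c + 0)      ≡⟨ cong₂ _+_ (sum-raise c y) (ℕₚ.+-identityʳ c) ⟩
  c * length y + sum y + c       ≡⟨ solve 3 (λ c l s → c :* l :+ s :+ c := c :* (con 1 :+ l) :+ s) refl c (length y) (sum y) ⟩
  c * suc (length y) + sum y     ∎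
  where
  open ≡-Reasoning
  open ℕ-Solver.+-*-Solver using (solve; _:+_; _:*_; _:=_; con)

!-dipped-raised : ∀ c y {j} → j < length y → dipped c y ! j ≡ c + y ! j
!-dipped-raised c y {j} j<y =
  trans (!-++ˡ (raise c y) _ (subst (j <_) (sym (length-map _ y)) j<y)) (!-map-< _ y j<y)

!-dipped-tail : ∀ c y d → dipped c y ! (d + length y) ≡ (0 ∷ c ∷ []) ! d
!-dipped-tail c y d = subst (λ k → dipped c y ! (d + k) ≡ (0 ∷ c ∷ []) ! d) (length-map _ y) (!-++ʳ (raise c y) _ d)

!-dipped-≤ : ∀ c y {j} → length y ≤ j → dipped c y ! j ≤ c
!-dipped-≤ c y {j} y≤j = subst (_≤ c) (trans (sym (!-dipped-tail c y (j ∸ length y))) (cong (dipped c y !_) (ℕₚ.m∸n+n≡m y≤j)))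
  (tail≤ (j ∸ length y))
  where
  tail≤ : ∀ d → (0 ∷ c ∷ []) ! d ≤ c
  tail≤ zero          = z≤n
  tail≤ (suc zero)    = ℕₚ.≤-refl
  tail≤ (suc (suc d)) = z≤n

dipped-height : ∀ {c c′ y y′} → dipped c y ≡ dipped c′ y′ → c ≡ c′
dipped-height {c} {c′} {y} {y′} eq =
  trans (sym (!-dipped-tail c y 1)) (trans (cong₂ _!_ eq (cong suc lengths)) (!-dipped-tail c′ y′ 1))
  where
  lengths : length y ≡ length y′
  lengths = ℕₚ.suc-injective (ℕₚ.suc-injective
    (trans (sym (length-dipped c y)) (trans (cong length eq) (length-dipped c′ y′))))

dipped-injective : ∀ {p q} → uncurry dipped p ≡ uncurry dipped q → p ≡ q
dipped-injective {c , y} {c′ , y′} eq with dipped-height eq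
... | refl = cong (c ,_) (map-injective (ℕₚ.+-cancelˡ-≡ c _ _) (++-cancelʳ (0 ∷ c ∷ []) (raise c y) (raise c y′) eq))

fence-dipped⁺ : ∀ c {y} → Fence y → Fence (dipped c y)
fence-dipped⁺ c {y} fy = fence-from-≤ below
  where
  below : ∀ {i j} → 2 + i ≤ j → dipped c y ! j ≤ dipped c y ! i
  below {i} {j} 2+i≤j with j ℕₚ.<? length y | i ℕₚ.<? length y
  ... | yes j<y | _       = subst₂ _≤_ (sym (!-dipped-raised c y j<y)) (sym (!-dipped-raised c y i<y))
                                       (ℕₚ.+-monoʳ-≤ c (fence-≤ fy 2+i≤j))
    where i<y = ℕₚ.<-trans (ℕₚ.≤-trans (ℕₚ.n≤1+n (suc i)) 2+i≤j) j<y
  ... | no j≮y  | yes i<y = ℕₚ.≤-trans (!-dipped-≤ c y (ℕₚ.≮⇒≥ j≮y))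
                              (subst (c ≤_) (sym (!-dipped-raised c y i<y)) (ℕₚ.m≤m+n c (y ! i)))
  ... | no j≮y  | no i≮y  = !-beyond-≤ (dipped c y) beyond
    where beyond = subst (_≤ j) (sym (length-dipped c y)) (ℕₚ.≤-trans (s≤s (s≤s (ℕₚ.≮⇒≥ i≮y))) 2+i≤j)

fence-dipped⁻ : ∀ c {y} → Fence (dipped c y) → Fence y
fence-dipped⁻ c {y} fx = fence-from-≤ below
  where
  below : ∀ {i j} → 2 + i ≤ j → y ! j ≤ y ! i
  below {i} {j} 2+i≤j with j ℕₚ.<? length y
  ... | yes j<y = ℕₚ.+-cancelˡ-≤ c (y ! j) (y ! i)
                    (subst₂ _≤_ (!-dipped-raised c y j<y) (!-dipped-raised c y i<y) (fence-≤ fx 2+i≤j))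
    where i<y = ℕₚ.<-trans (ℕₚ.≤-trans (ℕₚ.n≤1+n (suc i)) 2+i≤j) j<y
  ... | no j≮y  = !-beyond-≤ y (ℕₚ.≮⇒≥ j≮y)

head-dipped⁺ : ∀ a c y → 1 ≤ length y → HeadDescent a y → HeadDescent a (dipped c y)
head-dipped⁺ zero    c y            _ _    = tt
head-dipped⁺ (suc a) c (h ∷ [])     _ _    = z≤n
head-dipped⁺ (suc a) c (h ∷ h′ ∷ y) _ h′≤h = ℕₚ.+-monoʳ-≤ c h′≤h

head-dipped⁻ : ∀ a c y → HeadDescent a (dipped c y) → HeadDescent a y
head-dipped⁻ zero    c y            _ = tt
head-dipped⁻ (suc a) c []           _ = z≤n
head-dipped⁻ (suc a) c (h ∷ [])     _ = z≤n
head-dipped⁻ (suc a) c (h ∷ h′ ∷ y) d = ℕₚ.+-cancelˡ-≤ c h′ h d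

IsFence-dipped⁺ : ∀ {a k} c {y} → a ≡ 0 ⊎ 1 ≤ k → IsFence a k y → IsFence a (2 + k) (dipped c y)
IsFence-dipped⁺ {a} c {y} a≡0⊎1≤k (mkIsFence refl fy hy) = mkIsFence (length-dipped c y) (fence-dipped⁺ c fy) (head a≡0⊎1≤k)
  where
  head : a ≡ 0 ⊎ 1 ≤ length y → HeadDescent a (dipped c y)
  head (inj₁ refl) = tt
  head (inj₂ 1≤y)  = head-dipped⁺ a c y 1≤y hy

IsFence-dipped⁻ : ∀ {a k} c {y} → IsFence a (2 + k) (dipped c y) → IsFence a k y
IsFence-dipped⁻ {a} c {y} (mkIsFence lx fx hx) =
  mkIsFence (ℕₚ.suc-injective (ℕₚ.suc-injective (trans (sym (length-dipped c y)) lx))) (fence-dipped⁻ c fx) (head-dipped⁻ a c y hx)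

record Dip (a k m N : ℕ) (p : ℕ × List ℕ) : Set where
  constructor mkDip
  field
    height≥1 : 1 ≤ proj₁ p
    base     : IsFence a k (proj₂ p)
    max≡     : m ≡ proj₁ p + listMax (proj₂ p)
    sum≡     : N ≡ proj₁ p * suc k + sum (proj₂ p)

FenceWith-∷ʳ0⁺ : ∀ {a n m N y} → FenceWith a n m N y → FenceWith a (suc n) m N (y ∷ʳ 0)
FenceWith-∷ʳ0⁺ {y = y} (fenceWith fy my sy) =
  fenceWith (IsFence-∷ʳ0⁺ fy) (trans (listMax-∷ʳ0 y) my) (trans (sum-∷ʳ0 y) sy)

FenceWith-∷ʳ0⁻ : ∀ {a n m N y} → FenceWith a (suc n) m N (y ∷ʳ 0) → FenceWith a n m N y
FenceWith-∷ʳ0⁻ {y = y} (fenceWith fy my sy) =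
  fenceWith (IsFence-∷ʳ0⁻ fy) (trans (sym (listMax-∷ʳ0 y)) my) (trans (sym (sum-∷ʳ0 y)) sy)

FenceWith-raise⁺ : ∀ {a n m N y} → FenceWith a (suc n) m N y → FenceWith a (suc n) (suc m) (suc n + N) (raise 1 y)
FenceWith-raise⁺ {y = []}    (fenceWith (mkIsFence () _ _) _ _)
FenceWith-raise⁺ {y = h ∷ y} (fenceWith fy refl refl) = fenceWith (IsFence-raise⁺ 1 fy) (listMax-raise-∷ 1 h y)
  (trans (sum-raise 1 (h ∷ y)) (cong (_+ sum (h ∷ y)) (trans (ℕₚ.*-identityˡ _) (IsFence.length≡ fy))))

FenceWith-raise⁻ : ∀ {a n m N y} → FenceWith a (suc n) m N (raise 1 y) →
                   m ≡ suc (listMax y) × N ≡ suc n + sum y × FenceWith a (suc n) (listMax y) (sum y) y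
FenceWith-raise⁻ {y = []}    (fenceWith (mkIsFence () _ _) _ _)
FenceWith-raise⁻ {y = h ∷ y} (fenceWith fx refl refl) = listMax-raise-∷ 1 h y ,
  trans (sum-raise 1 (h ∷ y)) (cong (_+ sum (h ∷ y)) (trans (ℕₚ.*-identityˡ _) (IsFence.length≡ fy))) ,
  fenceWith fy refl refl
  where fy = IsFence-raise⁻ 1 fx

FenceWith-dipped⁺ : ∀ {a k m N c y} → a ≡ 0 ⊎ 1 ≤ k → Dip a k m N (c , y) → FenceWith a (2 + k) m N (dipped c y)
FenceWith-dipped⁺ {c = c} {y} a≡0⊎1≤k (mkDip _ fy refl refl) = fenceWith (IsFence-dipped⁺ c a≡0⊎1≤k fy)
  (listMax-dipped c y) (trans (sum-dipped c y) (cong (λ l → c * suc l + sum y) (IsFence.length≡ fy)))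

FenceWith-dipped⁻ : ∀ {a k m N c y} → 1 ≤ c → FenceWith a (2 + k) m N (dipped c y) → Dip a k m N (c , y)
FenceWith-dipped⁻ {c = c} {y} 1≤c (fenceWith fx refl refl) = mkDip 1≤c fy (listMax-dipped c y)
  (trans (sum-dipped c y) (cong (λ l → c * suc l + sum y) (IsFence.length≡ fy)))
  where fy = IsFence-dipped⁻ c fx

zero-or-positive : ∀ v → v ≡ 0 ⊎ 1 ≤ v
zero-or-positive zero    = inj₁ refl
zero-or-positive (suc v) = inj₂ (s≤s z≤n)

fence-positive-upto : ∀ {x} k → Fence x → 1 ≤ x ! k → 1 ≤ x ! suc k → ∀ j → j < 2 + k → 1 ≤ x ! j
fence-positive-upto {x} k fx 1≤x!k 1≤x!sk j j<2+k with ℕₚ.<-cmp j k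
... | tri< j<k _ _  = ℕₚ.≤-trans 1≤x!sk (fence-≤ fx (s≤s j<k))
... | tri≈ _ refl _ = 1≤x!k
... | tri> _ _ k<j  = subst (λ i → 1 ≤ x ! i) (sym (ℕₚ.≤-antisym (ℕₚ.≤-pred j<2+k) k<j)) 1≤x!sk

∷ʳ-view : ∀ n x → length x ≡ suc n → Σ[ y ∈ List ℕ ] x ≡ y ∷ʳ x ! n
∷ʳ-view n x lx with ++-view n x (trans lx (ℕₚ.+-comm 1 n))
... | y , v ∷ [] , refl , refl , refl = y , cong (y ∷ʳ_) (sym (!-++ʳ y (v ∷ []) 0))

dipped-view : ∀ k x → length x ≡ 2 + k → Fence x → x ! k ≡ 0 → Σ[ y ∈ List ℕ ] x ≡ dipped (x ! suc k) y
dipped-view k x lx fx x!k≡0 with ++-view k x (trans lx (ℕₚ.+-comm 2 k))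
... | y , u ∷ v ∷ [] , refl , refl , refl = lower v y , trans
  (cong₂ (λ y′ u′ → y′ ++ u′ ∷ v ∷ []) (sym (raise-lower v y v≤y)) u≡0)
  (cong (λ c → dipped c (lower v y)) (sym x!sk≡v))
  where
  u≡0 : u ≡ 0
  u≡0 = trans (sym (!-++ʳ y (u ∷ v ∷ []) 0)) x!k≡0
  x!sk≡v : (y ++ u ∷ v ∷ []) ! suc (length y) ≡ v
  x!sk≡v = !-++ʳ y (u ∷ v ∷ []) 1
  v≤y : ∀ j → j < length y → v ≤ y ! j
  v≤y j j<y = subst₂ _≤_ x!sk≡v (!-++ˡ y _ j<y) (fence-≤ fx (s≤s j<y))

zeroEnd-decomposition : ∀ {a n m N x} → FenceWith a (suc n) m N x → x ! n ≡ 0 →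
                        Σ[ y ∈ List ℕ ] x ≡ y ∷ʳ 0 × FenceWith a n m N y
zeroEnd-decomposition {a} {n} {m} {N} {x} fw x!n≡0 with ∷ʳ-view n x (IsFence.length≡ (FenceWith.isFence fw))
... | y , x≡ = y , x≡y∷ʳ0 , FenceWith-∷ʳ0⁻ (subst (FenceWith a (suc n) m N) x≡y∷ʳ0 fw)
  where
  x≡y∷ʳ0 : x ≡ y ∷ʳ 0
  x≡y∷ʳ0 = trans x≡ (cong (y ∷ʳ_) x!n≡0)

positive-decomposition : ∀ {a n m N x} → FenceWith a (suc n) (suc m) N x → (∀ j → j < suc n → 1 ≤ x ! j) →
                         Σ[ y ∈ List ℕ ] x ≡ raise 1 y × N ≡ suc n + sum y × FenceWith a (suc n) m (sum y) y
positive-decomposition {a} {n} {m} {N} {x} fw x≥1 =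
  lower 1 x , sym x≡ , proj₁ (proj₂ split) ,
  subst (λ k → FenceWith a (suc n) k _ (lower 1 x)) (sym (ℕₚ.suc-injective (proj₁ split))) (proj₂ (proj₂ split))
  where
  x≡ : raise 1 (lower 1 x) ≡ x
  x≡ = raise-lower 1 x (λ j j<x → x≥1 j (subst (j <_) (IsFence.length≡ (FenceWith.isFence fw)) j<x))
  split = FenceWith-raise⁻ (subst (FenceWith a (suc n) (suc m) N) (sym x≡) fw)

dipped-decomposition : ∀ {a k m N x} → FenceWith a (2 + k) m N x → x ! k ≡ 0 → 1 ≤ x ! suc k →
                       Σ[ y ∈ List ℕ ] x ≡ dipped (x ! suc k) y × Dip a k m N (x ! suc k , y)
dipped-decomposition {a} {k} {m} {N} {x} fw@(fenceWith (mkIsFence lx fx _) _ _) x!k≡0 1≤c with dipped-view k x lx fx x!k≡0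
... | y , x≡ = y , x≡ , FenceWith-dipped⁻ 1≤c (subst (FenceWith a (2 + k) m N) x≡ fw)

-- Enumerating fences

∈-shift⁺ : {A : Set} {x : A} → ∀ e {f : ℕ → List A} {t t′} → t ≡ e + t′ → x ∈ f t′ → x ∈ shift [] e f t
∈-shift⁺ e {f} {t′ = t′} refl x∈ = subst (_ ∈_) (sym (shift-+ e f t′)) x∈

∈-shift⁻ : {A : Set} {x : A} → ∀ e {f : ℕ → List A} t → x ∈ shift [] e f t → Σ[ t′ ∈ ℕ ] t ≡ e + t′ × x ∈ f t′
∈-shift⁻ zero    t       x∈ = t , refl , x∈
∈-shift⁻ (suc e) (suc t) x∈ with ∈-shift⁻ e t x∈
... | t′ , refl , x∈′ = t′ , refl , x∈′

Unique-shift : {A : Set} → ∀ e {f : ℕ → List A} → (∀ t → Unique (f t)) → ∀ t → Unique (shift [] e f t)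
Unique-shift = shift-preserves Unique []

height1 : List ℕ → ℕ × List ℕ
height1 y = 1 , y

bump : ℕ × List ℕ → ℕ × List ℕ
bump (c , y) = suc c , y

mutual
  fences : ℕ → ℕ → ℕ → ℕ → List (List ℕ)
  fences a zero    zero    zero    = [] ∷ []
  fences a zero    zero    (suc N) = []
  fences a zero    (suc m) N       = []
  fences a (suc n) m       N       = positiveFences a n m N ++ map (_∷ʳ 0) (fences a n m N) ++ dippedFences a n m N

  positiveFences : ℕ → ℕ → ℕ → ℕ → List (List ℕ)
  positiveFences a n zero    N = []
  positiveFences a n (suc m) N = shift [] (suc n) (λ N′ → map (raise 1) (fences a (suc n) m N′)) N

  dippedFences : ℕ → ℕ → ℕ → ℕ → List (List ℕ)
  dippedFences a       zero          m N = []
  dippedFences zero    (suc k)       m N = map (uncurry dipped) (dips zero k m N)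
  dippedFences (suc a) (suc zero)    m N = []   -- 0 ∷ c ∷ [] violates the head condition
  dippedFences (suc a) (suc (suc k)) m N = map (uncurry dipped) (dips (suc a) (suc k) m N)

  dips : ℕ → ℕ → ℕ → ℕ → List (ℕ × List ℕ)
  dips a k zero    N = []
  dips a k (suc m) N = shift [] (suc k) (λ N′ → map height1 (fences a k m N′) ++ map bump (dips a k m N′)) N

mutual
  fences-sound : ∀ a n m N {x} → x ∈ fences a n m N → FenceWith a n m N x
  fences-sound a zero zero zero (here refl) = fenceWith (mkIsFence refl (mkFence (λ _ → z≤n , z≤n)) (head-[] a)) refl refl
    where
    head-[] : ∀ a → HeadDescent a []
    head-[] zero    = tt
    head-[] (suc a) = z≤n
  fences-sound a (suc n) m N x∈ with ∈-++⁻ (positiveFences a n m N) x∈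
  ... | inj₁ x∈pos = positiveFences-sound a n m N x∈pos
  ... | inj₂ x∈rest with ∈-++⁻ (map (_∷ʳ 0) (fences a n m N)) x∈rest
  ...   | inj₂ x∈dip = dippedFences-sound a n m N x∈dip
  ...   | inj₁ x∈zero with ∈-map⁻ (_∷ʳ 0) x∈zero
  ...     | y , y∈ , refl = FenceWith-∷ʳ0⁺ (fences-sound a n m N y∈)

  positiveFences-sound : ∀ a n m N {x} → x ∈ positiveFences a n m N → FenceWith a (suc n) m N x
  positiveFences-sound a n (suc m) N x∈ with ∈-shift⁻ (suc n) N x∈
  ... | N′ , refl , x∈′ with ∈-map⁻ (raise 1) x∈′
  ...   | y , y∈ , refl = FenceWith-raise⁺ (fences-sound a (suc n) m N′ y∈)

  dippedFences-sound : ∀ a n m N {x} → x ∈ dippedFences a n m N → FenceWith a (suc n) m N x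
  dippedFences-sound zero (suc k) m N x∈ with ∈-map⁻ (uncurry dipped) x∈
  ... | (c , y) , p∈ , refl = FenceWith-dipped⁺ (inj₁ refl) (dips-sound zero k m N p∈)
  dippedFences-sound (suc a) (suc (suc k)) m N x∈ with ∈-map⁻ (uncurry dipped) x∈
  ... | (c , y) , p∈ , refl = FenceWith-dipped⁺ (inj₂ (s≤s z≤n)) (dips-sound (suc a) (suc k) m N p∈)

  dips-sound : ∀ a k m N {p} → p ∈ dips a k m N → Dip a k m N p
  dips-sound a k (suc m) N p∈ with ∈-shift⁻ (suc k) N p∈
  ... | N′ , refl , p∈′ with ∈-++⁻ (map height1 (fences a k m N′)) p∈′
  ...   | inj₁ p∈first with ∈-map⁻ height1 p∈first
  ...     | y , y∈ , refl with fences-sound a k m N′ y∈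
  ...       | fenceWith fy refl refl = mkDip (s≤s z≤n) fy refl (cong (_+ sum y) (sym (ℕₚ.+-identityʳ (suc k))))
  dips-sound a k (suc m) N p∈ | N′ , refl , p∈′ | inj₂ p∈bumped with ∈-map⁻ bump p∈bumped
  ...     | (c , y) , q∈ , refl with dips-sound a k m N′ q∈
  ...       | mkDip _ fy refl refl = mkDip (s≤s z≤n) fy refl (sym (ℕₚ.+-assoc (suc k) (c * suc k) (sum y)))

mutual
  fences-complete : ∀ a n m N {x} → FenceWith a n m N x → x ∈ fences a n m N
  fences-complete a zero    m N {[]}    (fenceWith _ refl refl) = here refl
  fences-complete a zero    m N {h ∷ x} (fenceWith (mkIsFence () _ _) _ _)
  fences-complete a (suc n) m N {x}     fw with zero-or-positive (x ! n)
  ... | inj₁ x!n≡0 = ∈-++⁺ʳ (positiveFences a n m N) (∈-++⁺ˡ (zeroEnd-complete a n m N fw x!n≡0))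
  fences-complete a (suc zero) m N {x} fw | inj₂ 1≤x!0 =
    ∈-++⁺ˡ (positiveFences-complete a zero m N fw (λ { zero _ → 1≤x!0 ; (suc j) (s≤s ()) }))
  fences-complete a (suc (suc k)) m N {x} fw | inj₂ 1≤x!sk with zero-or-positive (x ! k)
  ... | inj₂ 1≤x!k = ∈-++⁺ˡ (positiveFences-complete a (suc k) m N fw
                       (fence-positive-upto k (IsFence.fence (FenceWith.isFence fw)) 1≤x!k 1≤x!sk))
  ... | inj₁ x!k≡0 = ∈-++⁺ʳ (positiveFences a (suc k) m N)
                       (∈-++⁺ʳ (map (_∷ʳ 0) (fences a (suc k) m N)) (dippedFences-complete a k m N fw x!k≡0 1≤x!sk))

  zeroEnd-complete : ∀ a n m N {x} → FenceWith a (suc n) m N x → x ! n ≡ 0 → x ∈ map (_∷ʳ 0) (fences a n m N)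
  zeroEnd-complete a n m N fw x!n≡0 with zeroEnd-decomposition fw x!n≡0
  ... | y , refl , fy = ∈-map⁺ (_∷ʳ 0) (fences-complete a n m N fy)

  positiveFences-complete : ∀ a n m N {x} → FenceWith a (suc n) m N x → (∀ j → j < suc n → 1 ≤ x ! j) →
                            x ∈ positiveFences a n m N
  positiveFences-complete a n zero N {x} fw x≥1 =
    ⊥-elim (ℕₚ.<⇒≱ (ℕₚ.≤-trans (x≥1 0 (s≤s z≤n)) (!-≤-listMax x 0)) (ℕₚ.≤-reflexive (FenceWith.max≡ fw)))
  positiveFences-complete a n (suc m) N fw x≥1 with positive-decomposition fw x≥1
  ... | y , refl , N≡ , fy = ∈-shift⁺ (suc n) N≡ (∈-map⁺ (raise 1) (fences-complete a (suc n) m (sum y) fy))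

  dippedFences-complete : ∀ a k m N {x} → FenceWith a (2 + k) m N x → x ! k ≡ 0 → 1 ≤ x ! suc k →
                          x ∈ dippedFences a (suc k) m N
  dippedFences-complete zero k m N {x} fw x!k≡0 1≤c with dipped-decomposition fw x!k≡0 1≤c
  ... | y , x≡ , d = subst (_∈ dippedFences zero (suc k) m N) (sym x≡) (∈-map⁺ (uncurry dipped) (dips-complete zero k m N d))
  dippedFences-complete (suc a) zero m N fw x!0≡0 1≤c
    with subst (1 ≤_) x!0≡0 (ℕₚ.≤-trans 1≤c (IsFence.head (FenceWith.isFence fw)))
  ... | ()
  dippedFences-complete (suc a) (suc k) m N {x} fw x!k≡0 1≤c with dipped-decomposition fw x!k≡0 1≤c
  ... | y , x≡ , d = subst (_∈ dippedFences (suc a) (suc (suc k)) m N) (sym x≡)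
                       (∈-map⁺ (uncurry dipped) (dips-complete (suc a) (suc k) m N d))

  dips-complete : ∀ a k m N {p} → Dip a k m N p → p ∈ dips a k m N
  dips-complete a k m N {suc zero , y} (mkDip _ fy refl refl) =
    ∈-shift⁺ (suc k) (ℕₚ.+-assoc (suc k) 0 (sum y))
      (∈-++⁺ˡ (∈-map⁺ height1 (fences-complete a k (listMax y) (sum y) (fenceWith fy refl refl))))
  dips-complete a k m N {suc (suc c) , y} (mkDip _ fy refl refl) =
    ∈-shift⁺ (suc k) (ℕₚ.+-assoc (suc k) (suc c * suc k) (sum y))
      (∈-++⁺ʳ (map height1 (fences a k (suc c + listMax y) (suc c * suc k + sum y)))
        (∈-map⁺ bump (dips-complete a k (suc c + listMax y) (suc c * suc k + sum y) (mkDip (s≤s z≤n) fy refl refl))))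

positiveFences-shape : ∀ a n m N {x} → x ∈ positiveFences a n m N → ∀ j → j < suc n → 1 ≤ x ! j
positiveFences-shape a n (suc m) N x∈ j j<sn with ∈-shift⁻ (suc n) N x∈
... | N′ , refl , x∈′ with ∈-map⁻ (raise 1) x∈′
...   | y , y∈ , refl = ℕₚ.≤-trans (s≤s z≤n) (ℕₚ.≤-reflexive (sym (!-map-< (_+_ 1) y j<y)))
  where j<y = subst (j <_) (sym (IsFence.length≡ (FenceWith.isFence (fences-sound a (suc n) m N′ y∈)))) j<sn

zeroEnd-shape : ∀ a n m N {x} → x ∈ map (_∷ʳ 0) (fences a n m N) → x ! n ≡ 0
zeroEnd-shape a n m N x∈ with ∈-map⁻ (_∷ʳ 0) x∈
... | y , y∈ , refl =
  subst (λ k → (y ∷ʳ 0) ! k ≡ 0) (IsFence.length≡ (FenceWith.isFence (fences-sound a n m N y∈))) (!-++ʳ y (0 ∷ []) 0)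

dips-shape : ∀ a k m N {x} → x ∈ map (uncurry dipped) (dips a k m N) → x ! k ≡ 0 × 1 ≤ x ! suc k
dips-shape a k m N x∈ with ∈-map⁻ (uncurry dipped) x∈
... | (c , y) , p∈ , refl with dips-sound a k m N p∈
...   | mkDip 1≤c (mkIsFence refl _ _) _ _ = !-dipped-tail c y 0 , subst (1 ≤_) (sym (!-dipped-tail c y 1)) 1≤c

dippedFences-shape : ∀ a n m N {x} → x ∈ dippedFences a n m N → Σ[ k ∈ ℕ ] n ≡ suc k × x ! k ≡ 0 × 1 ≤ x ! suc k
dippedFences-shape zero    (suc k)       m N x∈ = k , refl , dips-shape zero k m N x∈
dippedFences-shape (suc a) (suc (suc k)) m N x∈ = suc k , refl , dips-shape (suc a) (suc k) m N x∈

mutual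
  fences-unique : ∀ a n m N → Unique (fences a n m N)
  fences-unique a zero    zero    zero    = All.[] ∷ []
  fences-unique a zero    zero    (suc N) = []
  fences-unique a zero    (suc m) N       = []
  fences-unique a (suc n) m       N       =
    Unique.++⁺ (positiveFences-unique a n m N)
      (Unique.++⁺ (Unique.map⁺ (∷ʳ-injectiveˡ _ _) (fences-unique a n m N)) (dippedFences-unique a n m N) zeroEnd∩dipped)
      positive∩rest
    where
    zeroEnd∩dipped : ∀ {x} → ¬ (x ∈ map (_∷ʳ 0) (fences a n m N) × x ∈ dippedFences a n m N)
    zeroEnd∩dipped (x∈zero , x∈dip) with dippedFences-shape a n m N x∈dip
    ... | k , refl , _ , 1≤x!n = ℕₚ.<⇒≱ 1≤x!n (ℕₚ.≤-reflexive (zeroEnd-shape a n m N x∈zero))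
    positive∩rest : ∀ {x} → ¬ (x ∈ positiveFences a n m N × x ∈ map (_∷ʳ 0) (fences a n m N) ++ dippedFences a n m N)
    positive∩rest (x∈pos , x∈rest) with ∈-++⁻ (map (_∷ʳ 0) (fences a n m N)) x∈rest
    ... | inj₁ x∈zero =
      ℕₚ.<⇒≱ (positiveFences-shape a n m N x∈pos n ℕₚ.≤-refl) (ℕₚ.≤-reflexive (zeroEnd-shape a n m N x∈zero))
    ... | inj₂ x∈dip with dippedFences-shape a n m N x∈dip
    ...   | k , refl , x!k≡0 , _ =
      ℕₚ.<⇒≱ (positiveFences-shape a n m N x∈pos k (ℕₚ.n≤1+n (suc k))) (ℕₚ.≤-reflexive x!k≡0)

  positiveFences-unique : ∀ a n m N → Unique (positiveFences a n m N)
  positiveFences-unique a n zero    N = []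
  positiveFences-unique a n (suc m) N =
    Unique-shift (suc n) (λ N′ → Unique.map⁺ (map-injective ℕₚ.suc-injective) (fences-unique a (suc n) m N′)) N

  dippedFences-unique : ∀ a n m N → Unique (dippedFences a n m N)
  dippedFences-unique a       zero          m N = []
  dippedFences-unique zero    (suc k)       m N = Unique.map⁺ dipped-injective (dips-unique zero k m N)
  dippedFences-unique (suc a) (suc zero)    m N = []
  dippedFences-unique (suc a) (suc (suc k)) m N = Unique.map⁺ dipped-injective (dips-unique (suc a) (suc k) m N)

  dips-unique : ∀ a k m N → Unique (dips a k m N)
  dips-unique a k zero    N = []
  dips-unique a k (suc m) N = Unique-shift (suc k) (λ N′ →
    Unique.++⁺ (Unique.map⁺ (λ eq → cong proj₂ eq) (fences-unique a k m N′))
               (Unique.map⁺ bump-injective (dips-unique a k m N′))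
               (first∩bumped N′)) N
    where
    bump-injective : ∀ {p q} → bump p ≡ bump q → p ≡ q
    bump-injective {c , y} {c′ , y′} eq = cong₂ _,_ (ℕₚ.suc-injective (cong proj₁ eq)) (cong proj₂ eq)
    first∩bumped : ∀ N′ {p} → ¬ (p ∈ map height1 (fences a k m N′) × p ∈ map bump (dips a k m N′))
    first∩bumped N′ (p∈first , p∈bumped) with ∈-map⁻ height1 p∈first | ∈-map⁻ bump p∈bumped
    ... | y , _ , refl | (c , z) , q∈ , eq with dips-sound a k m N′ q∈
    ...   | mkDip 1≤c _ _ _ = ℕₚ.<⇒≱ (s≤s 1≤c) (ℕₚ.≤-reflexive (sym (cong proj₁ eq)))

Enumerates : {A : Set} → (A → Set) → List A → Set
Enumerates P xs = Unique xs × (∀ x → x ∈ xs ⇔ P x)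

Enumerates-bijection : {A B : Set} {P : A → Set} {Q : B → Set} (f : A → B) (g : B → A) →
                       (∀ {x} → P x → Q (f x) × g (f x) ≡ x) → (∀ {y} → Q y → P (g y) × f (g y) ≡ y) →
                       ∀ {xs} → Enumerates P xs → Enumerates Q (map f xs)
Enumerates-bijection {P = P} f g PQ QP {xs} (uniq , xs⇔P) = unique uniq (λ {x} x∈ → Equivalence.to (xs⇔P x) x∈) , λ y → mk⇔
  (λ y∈ → case ∈-map⁻ f y∈ of λ { (x , x∈ , refl) → proj₁ (PQ (Equivalence.to (xs⇔P x) x∈)) })
  (λ Qy → subst (_∈ map f xs) (proj₂ (QP Qy)) (∈-map⁺ f (Equivalence.from (xs⇔P (g y)) (proj₁ (QP Qy)))))
  where
  injective : ∀ {x x′} → P x → P x′ → f x ≡ f x′ → x ≡ x′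
  injective Px Px′ eq = trans (sym (proj₂ (PQ Px))) (trans (cong g eq) (proj₂ (PQ Px′)))
  unique : ∀ {xs} → Unique xs → (∀ {x} → x ∈ xs → P x) → Unique (map f xs)
  unique []           _   = []
  unique (x∉xs ∷ uxs) Pxs = Allₚ.map⁺ (All.tabulate λ y∈ fx≡fy →
    All.lookup x∉xs y∈ (injective (Pxs (here refl)) (Pxs (there y∈)) fx≡fy)) ∷ unique uxs (Pxs ∘ there)

fences-enumerate : ∀ a n m N → Enumerates (FenceWith a n m N) (fences a n m N)
fences-enumerate a n m N = fences-unique a n m N , λ x → mk⇔ (fences-sound a n m N) (fences-complete a n m N)

-- Generating functions of fences

count : {A : Set} → (ℕ → ℕ → List A) → Series
count xs m N = + length (xs m N)

count-shift : {A : Set} → ∀ e (f : ℕ → List A) N →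
              + length (shift [] e f N) ≡ shift (+ 0) e (λ t → + length (f t)) N
count-shift e f N = sym (shift-map (λ l → + length l) refl e f N)

count-fences-suc : ∀ a n → [1-zq^ suc n ]· count (fences a (suc n)) ≈ count (fences a n) ⊕ count (dippedFences a n)
count-fences-suc a n = [1-zq^]-solve (suc n) λ m N → trans (cong +_ (length-++ (positiveFences a n m N)))
  (cong₂ _+ℤ_ (positive m N) (cong +_ (trans (length-++ (map (_∷ʳ 0) (fences a n m N)))
    (cong (_+ length (dippedFences a n m N)) (length-map (_∷ʳ 0) (fences a n m N))))))
  where
  positive : ∀ m N → + length (positiveFences a n m N) ≡ (zq^ suc n · count (fences a (suc n))) m N
  positive zero    N = refl
  positive (suc m) N = trans (count-shift (suc n) _ N)
    (shift-cong (suc n) (λ t → cong +_ (length-map (raise 1) (fences a (suc n) m t))) N)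

count-dips : ∀ a k → [1-zq^ suc k ]· count (dips a k) ≈ zq^ suc k · count (fences a k)
count-dips a k = [1-zq^]-solve (suc k) λ m N → trans (unfold m N)
  (trans (zq^-⊕ (suc k) (count (fences a k)) (count (dips a k)) m N)
         (ℤₚ.+-comm ((zq^ suc k · count (fences a k)) m N) ((zq^ suc k · count (dips a k)) m N)))
  where
  unfold : count (dips a k) ≈ zq^ suc k · (count (fences a k) ⊕ count (dips a k))
  unfold zero    N = refl
  unfold (suc m) N = trans (count-shift (suc k) _ N) (shift-cong (suc k) (λ t → cong +_
    (trans (length-++ (map height1 (fences a k m t)))
           (cong₂ _+_ (length-map height1 (fences a k m t)) (length-map bump (dips a k m t))))) N)

count-dippedFences : ∀ a k → a ≡ 0 ⊎ 1 ≤ k → count (dippedFences a (suc k)) ≈ count (dips a k)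
count-dippedFences zero    k       _           m N = cong +_ (length-map (uncurry dipped) (dips zero k m N))
count-dippedFences (suc a) zero    (inj₁ ())
count-dippedFences (suc a) zero    (inj₂ ())
count-dippedFences (suc a) (suc k) _           m N = cong +_ (length-map (uncurry dipped) (dips (suc a) (suc k) m N))

pochCount : ℕ → ℕ → Series
pochCount a n = poch n · count (fences a n)

pochCount-suc : ∀ a n → pochCount a (suc n) ≈ pochCount a n ⊕ poch n · count (dippedFences a n)
pochCount-suc a n m N = begin
  ([1-zq^ suc n ]· poch n · count (fences a (suc n))) m N
    ≡⟨ poch-[1-zq^] n (suc n) (count (fences a (suc n))) m N ⟨
  (poch n · [1-zq^ suc n ]· count (fences a (suc n))) m N
    ≡⟨ poch-cong n (count-fences-suc a n) m N ⟩
  (poch n · (count (fences a n) ⊕ count (dippedFences a n))) m N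
    ≡⟨ poch-⊕ n (count (fences a n)) (count (dippedFences a n)) m N ⟩
  (pochCount a n ⊕ poch n · count (dippedFences a n)) m N ∎
  where open ≡-Reasoning

poch-dips : ∀ a k → poch (suc k) · count (dips a k) ≈ zq^ suc k · pochCount a k
poch-dips a k m N = begin
  ([1-zq^ suc k ]· poch k · count (dips a k)) m N   ≡⟨ poch-[1-zq^] k (suc k) (count (dips a k)) m N ⟨
  (poch k · [1-zq^ suc k ]· count (dips a k)) m N   ≡⟨ poch-cong k (count-dips a k) m N ⟩
  (poch k · zq^ suc k · count (fences a k)) m N     ≡⟨ poch-zq^ k (suc k) (count (fences a k)) m N ⟩
  (zq^ suc k · pochCount a k) m N                   ∎
  where open ≡-Reasoning

pochCount-rec : ∀ a k → a ≡ 0 ⊎ 1 ≤ k → pochCount a (2 + k) ≈ pochCount a (1 + k) ⊕ zq^ suc k · pochCount a k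
pochCount-rec a k a≡0⊎1≤k m N = trans (pochCount-suc a (suc k) m N) (cong (pochCount a (suc k) m N +ℤ_)
  (≈-trans (poch-cong (suc k) (count-dippedFences a k a≡0⊎1≤k)) (poch-dips a k) m N))

pochCount-empty : ∀ a n → count (dippedFences a n) ≈ 0ₛ → pochCount a (suc n) ≈ pochCount a n
pochCount-empty a n dip≈0 m N = trans (pochCount-suc a n m N)
  (trans (cong (pochCount a n m N +ℤ_) (≈-trans (poch-cong n dip≈0) (poch-0ₛ n) m N)) (ℤₚ.+-identityʳ _))

pochCount-0 : ∀ a → pochCount a 0 ≈ one
pochCount-0 a zero    zero    = refl
pochCount-0 a zero    (suc N) = refl
pochCount-0 a (suc m) N       = refl

pochCount-1 : ∀ a → pochCount a 1 ≈ one
pochCount-1 a = ≈-trans (pochCount-empty a 0 (λ _ _ → refl)) (pochCount-0 a)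

pochCount≈binomialSum-0 : ∀ n → pochCount 0 n ≈ binomialSum 0 n
pochCount≈binomialSum-0 = recurrence-unique (pochCount 0) (binomialSum 0) suc
  (≈-trans (pochCount-0 0) (≈-sym (binomialSum-initial 0 0 z≤n)))
  (≈-trans (pochCount-1 0) (≈-sym (binomialSum-initial 0 1 (s≤s z≤n))))
  (λ k → pochCount-rec 0 k (inj₁ refl)) (binomialSum-rec 0)

pochCount≈binomialSum-1 : ∀ n → pochCount 1 (suc n) ≈ binomialSum 1 n
pochCount≈binomialSum-1 = recurrence-unique (pochCount 1 ∘ suc) (binomialSum 1) (suc ∘ suc)
  (≈-trans (pochCount-1 1) (≈-sym (binomialSum-initial 1 0 z≤n)))
  (≈-trans (pochCount-empty 1 1 (λ _ _ → refl)) (≈-trans (pochCount-1 1) (≈-sym (binomialSum-initial 1 1 (s≤s z≤n)))))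
  (λ k → pochCount-rec 1 (suc k) (inj₂ (s≤s z≤n))) (binomialSum-rec 1)

pochCount≈binomialSum : ∀ {a} → a ≤ 1 → ∀ n → pochCount a (n + a) ≈ binomialSum a n
pochCount≈binomialSum z≤n       n m N =
  trans (cong (λ k → pochCount 0 k m N) (ℕₚ.+-identityʳ n)) (pochCount≈binomialSum-0 n m N)
pochCount≈binomialSum (s≤s z≤n) n m N =
  trans (cong (λ k → pochCount 1 k m N) (ℕₚ.+-comm n 1)) (pochCount≈binomialSum-1 n m N)

-- Cylindric partitions as fences

data Aligned : List ℕ → List ℕ → List ℕ → Set where
  []   : Aligned [] [] []
  cons : ∀ {u v w us vs ws} → Aligned us vs ws → Aligned (u ∷ us) (v ∷ vs) (w ∷ ws)

aligned : ∀ us vs ws → length vs ≡ length us → length ws ≡ length us → Aligned us vs ws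
aligned []       []       []       _  _  = []
aligned (u ∷ us) (v ∷ vs) (w ∷ ws) lv lw = cons (aligned us vs ws (ℕₚ.suc-injective lv) (ℕₚ.suc-injective lw))

aligned-lengths : ∀ {us vs ws} → Aligned us vs ws → length vs ≡ length us × length ws ≡ length us
aligned-lengths []        = refl , refl
aligned-lengths (cons al) = cong suc (proj₁ (aligned-lengths al)) , cong suc (proj₂ (aligned-lengths al))

weave : List ℕ → List ℕ → List ℕ → List ℕ
weave (u ∷ us) (v ∷ vs) (w ∷ ws) = u ∷ v ∷ w ∷ weave us vs ws
weave _        _        _        = []

strand : ℕ → List ℕ → List ℕ
strand i (u ∷ v ∷ w ∷ x) = (u ∷ v ∷ w ∷ []) ! i ∷ strand i x
strand i _               = []

length-weave : ∀ {us vs ws} → Aligned us vs ws → length (weave us vs ws) ≡ length us * 3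
length-weave []        = refl
length-weave (cons al) = cong (λ l → suc (suc (suc l))) (length-weave al)

strand-weave : ∀ {us vs ws} → Aligned us vs ws →
               strand 0 (weave us vs ws) ≡ us × strand 1 (weave us vs ws) ≡ vs × strand 2 (weave us vs ws) ≡ ws
strand-weave []                                  = refl , refl , refl
strand-weave {u ∷ us} {v ∷ vs} {w ∷ ws} (cons al) with strand-weave al
... | eu , ev , ew = cong (u ∷_) eu , cong (v ∷_) ev , cong (w ∷_) ew

weave-strand : ∀ L x → length x ≡ L * 3 →
               Aligned (strand 0 x) (strand 1 x) (strand 2 x) ×
               weave (strand 0 x) (strand 1 x) (strand 2 x) ≡ x × length (strand 0 x) ≡ L
weave-strand zero    []              refl = [] , refl , refl
weave-strand (suc L) (u ∷ v ∷ w ∷ x) lx with weave-strand L x (ℕₚ.suc-injective (ℕₚ.suc-injective (ℕₚ.suc-injective lx)))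
... | al , ex , lu = cons al , cong (λ y → u ∷ v ∷ w ∷ y) ex , cong suc lu

!-weave : ∀ {us vs ws} → Aligned us vs ws → ∀ k →
          weave us vs ws ! (k * 3) ≡ us ! k × weave us vs ws ! suc (k * 3) ≡ vs ! k × weave us vs ws ! suc (suc (k * 3)) ≡ ws ! k
!-weave []        k       = refl , refl , refl
!-weave (cons al) zero    = refl , refl , refl
!-weave (cons al) (suc k) = !-weave al k

by-residue : (P : ℕ → Set) → (∀ k → P (k * 3) × P (suc (k * 3)) × P (suc (suc (k * 3)))) → ∀ i → P i
by-residue P P3 zero                = proj₁ (P3 0)
by-residue P P3 (suc zero)          = proj₁ (proj₂ (P3 0))
by-residue P P3 (suc (suc zero))    = proj₂ (proj₂ (P3 0))
by-residue P P3 (suc (suc (suc i))) = by-residue (λ i → P (3 + i)) (λ k → P3 (suc k)) i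

regroup-weave : (M : CommutativeMonoid 0ℓ 0ℓ) → let open CommutativeMonoid M using (_∙_; ε) renaming (_≈_ to _≈ₘ_) in
                ∀ u v w U V W → u ∙ (v ∙ (w ∙ (V ∙ (U ∙ (W ∙ ε))))) ≈ₘ (v ∙ V) ∙ ((u ∙ U) ∙ ((w ∙ W) ∙ ε))
regroup-weave M u v w U V W = prove 6
  (u′ ⊙ (v′ ⊙ (w′ ⊙ (V′ ⊙ (U′ ⊙ (W′ ⊙ id))))))
  ((v′ ⊙ V′) ⊙ ((u′ ⊙ U′) ⊙ ((w′ ⊙ W′) ⊙ id)))
  (u ∷ v ∷ w ∷ U ∷ V ∷ W ∷ [])
  where
  open import Algebra.Solver.CommutativeMonoid M using (prove; var; id) renaming (_⊕_ to _⊙_)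
  u′ = var (Fin.# 0)
  v′ = var (Fin.# 1)
  w′ = var (Fin.# 2)
  U′ = var (Fin.# 3)
  V′ = var (Fin.# 4)
  W′ = var (Fin.# 5)

listMax-weave : ∀ {us vs ws} → Aligned us vs ws → listMax (weave us vs ws) ≡ listMax vs ⊔ (listMax us ⊔ (listMax ws ⊔ 0))
listMax-weave []                                  = refl
listMax-weave {u ∷ us} {v ∷ vs} {w ∷ ws} (cons al) = trans (cong (λ t → u ⊔ (v ⊔ (w ⊔ t))) (listMax-weave al))
  (regroup-weave ℕₚ.⊔-0-commutativeMonoid u v w (listMax us) (listMax vs) (listMax ws))

sum-weave : ∀ {us vs ws} → Aligned us vs ws → sum (weave us vs ws) ≡ sum vs + (sum us + (sum ws + 0))
sum-weave []                                  = refl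
sum-weave {u ∷ us} {v ∷ vs} {w ∷ ws} (cons al) = trans (cong (λ t → u + (v + (w + t))) (sum-weave al))
  (regroup-weave ℕₚ.+-0-commutativeMonoid u v w (sum us) (sum vs) (sum ws))

record Interlaced (r₁ r₂ r₃ : List ℕ) : Set where
  constructor mkInterlaced
  field
    row₁  : ∀ k → r₁ ! suc k ≤ r₁ ! k
    row₂  : ∀ k → r₂ ! suc k ≤ r₂ ! k
    row₃  : ∀ k → r₃ ! suc k ≤ r₃ ! k
    col₁₂ : ∀ k → r₂ ! suc k ≤ r₁ ! k
    col₂₃ : ∀ k → r₃ ! k ≤ r₂ ! k
    col₃₁ : ∀ k → r₁ ! suc k ≤ r₃ ! k

Fence-weave⁻ : ∀ {r₁ r₂ r₃} → Aligned r₂ r₁ r₃ → Fence (weave r₂ r₁ r₃) → Interlaced r₁ r₂ r₃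
Fence-weave⁻ al fx = mkInterlaced
  (λ k → subst₂ _≤_ (at₁ (suc k)) (at₁ k) (proj₂ (descends fx (suc (k * 3)))))
  (λ k → subst₂ _≤_ (at₂ (suc k)) (at₂ k) (proj₂ (descends fx (k * 3))))
  (λ k → subst₂ _≤_ (at₃ (suc k)) (at₃ k) (proj₂ (descends fx (suc (suc (k * 3))))))
  (λ k → subst₂ _≤_ (at₂ (suc k)) (at₁ k) (proj₁ (descends fx (suc (k * 3)))))
  (λ k → subst₂ _≤_ (at₃ k) (at₂ k) (proj₁ (descends fx (k * 3))))
  (λ k → subst₂ _≤_ (at₁ (suc k)) (at₃ k) (proj₁ (descends fx (suc (suc (k * 3))))))
  where
  at₂ = λ k → proj₁ (!-weave al k)
  at₁ = λ k → proj₁ (proj₂ (!-weave al k))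
  at₃ = λ k → proj₂ (proj₂ (!-weave al k))

Fence-weave⁺ : ∀ {r₁ r₂ r₃} → Aligned r₂ r₁ r₃ → Interlaced r₁ r₂ r₃ → Fence (weave r₂ r₁ r₃)
Fence-weave⁺ {r₁} {r₂} {r₃} al (mkInterlaced row₁ row₂ row₃ col₁₂ col₂₃ col₃₁) = mkFence (by-residue _ λ k →
  (subst₂ _≤_ (sym (at₃ k)) (sym (at₂ k)) (col₂₃ k) , subst₂ _≤_ (sym (at₂ (suc k))) (sym (at₂ k)) (row₂ k)) ,
  (subst₂ _≤_ (sym (at₂ (suc k))) (sym (at₁ k)) (col₁₂ k) , subst₂ _≤_ (sym (at₁ (suc k))) (sym (at₁ k)) (row₁ k)) ,
  (subst₂ _≤_ (sym (at₁ (suc k))) (sym (at₃ k)) (col₃₁ k) , subst₂ _≤_ (sym (at₃ (suc k))) (sym (at₃ k)) (row₃ k)))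
  where
  at₂ = λ k → proj₁ (!-weave al k)
  at₁ = λ k → proj₁ (proj₂ (!-weave al k))
  at₃ = λ k → proj₂ (proj₂ (!-weave al k))

Fence-∷⁺ : ∀ {h x} → Fence x → x ! 1 ≤ h → x ! 2 ≤ h → Fence (h ∷ x)
Fence-∷⁺ fx x₁≤h x₂≤h = mkFence λ { zero → x₁≤h , x₂≤h ; (suc i) → descends fx i }

Fence-∷⁻ : ∀ {h x} → Fence (h ∷ x) → Fence x × x ! 1 ≤ h × x ! 2 ≤ h
Fence-∷⁻ fhx = mkFence (λ i → descends fhx (suc i)) , proj₁ (descends fhx 0) , proj₂ (descends fhx 0)

!-≤-inside : ∀ r j {v} → (j < length r → r ! j ≤ v) → r ! j ≤ v
!-≤-inside r j inside with j ℕₚ.<? length r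
... | yes j<r = inside j<r
... | no  j≮r = !-beyond-≤ r (ℕₚ.≮⇒≥ j≮r)

<⇒≤∸1 : ∀ {m n} → m < n → m ≤ n ∸ 1
<⇒≤∸1 {n = suc n} (s≤s m≤n) = m≤n

j+0+2≡2+j : ∀ j → j + 0 + 2 ≡ 2 + j
j+0+2≡2+j j = trans (cong (_+ 2) (ℕₚ.+-identityʳ j)) (ℕₚ.+-comm j 2)

Interlaced⇒IsCylindric₀ : ∀ L {r₁ r₂ r₃} → length r₁ ≡ L → length r₂ ≡ L → length r₃ ≡ L →
                          Interlaced r₁ r₂ r₃ → IsCylindric (shapeLa L 0) (r₁ ∷ r₂ ∷ r₃ ∷ [])
Interlaced⇒IsCylindric₀ L {r₁} {r₂} {r₃} l₁ l₂ l₃ (mkInterlaced row₁ row₂ row₃ col₁₂ col₂₃ col₃₁) = record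
  { nrows  = refl
  ; rowlen = λ { 1 _ _ → l₁ ; 2 _ _ → l₂ ; 3 _ _ → l₃ ; (suc (suc (suc (suc i)))) _ (s≤s (s≤s (s≤s ()))) }
  ; rowdec = λ { 1 (suc j) _ _ _ _ → row₁ j ; 2 (suc j) _ _ _ _ → row₂ j ; 3 (suc j) _ _ _ _ → row₃ j
               ; (suc (suc (suc (suc i)))) _ _ (s≤s (s≤s (s≤s ()))) }
  ; coldec = λ { 1 (suc j) _ _ _ _ → subst (λ k → r₂ ! k ≤ r₁ ! j) (ℕₚ.+-comm 1 j) (col₁₂ j)
               ; 2 (suc j) _ _ _ _ → subst (λ k → r₃ ! k ≤ r₂ ! j) (sym (ℕₚ.+-identityʳ j)) (col₂₃ j)
               ; (suc (suc (suc i))) _ _ (s≤s (s≤s (s≤s ()))) }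
  ; cycdec = λ { (suc j) _ _ → subst (λ k → r₁ ! k ≤ r₃ ! j) (sym (cong (_∸ 1) (j+0+2≡2+j j))) (col₃₁ j) }
  }

IsCylindric₀⇒Interlaced : ∀ L {r₁ r₂ r₃} → IsCylindric (shapeLa L 0) (r₁ ∷ r₂ ∷ r₃ ∷ []) →
                          (length r₁ ≡ L × length r₂ ≡ L × length r₃ ≡ L) × Interlaced r₁ r₂ r₃
IsCylindric₀⇒Interlaced L {r₁} {r₂} {r₃} c = (l₁ , l₂ , l₃) , mkInterlaced
  (λ k → !-≤-inside r₁ (suc k) (rowdec 1 (suc k) (s≤s z≤n) (s≤s z≤n) (s≤s z≤n)))
  (λ k → !-≤-inside r₂ (suc k) (rowdec 2 (suc k) (s≤s z≤n) (s≤s (s≤s z≤n)) (s≤s z≤n)))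
  (λ k → !-≤-inside r₃ (suc k) (rowdec 3 (suc k) (s≤s z≤n) ℕₚ.≤-refl (s≤s z≤n)))
  (λ k → !-≤-inside r₂ (suc k) λ sk<r₂ → subst (λ i → r₂ ! i ≤ r₁ ! k) (ℕₚ.+-comm k 1)
           (coldec 1 (suc k) (s≤s z≤n) (s≤s (s≤s z≤n)) (s≤s z≤n) (<⇒≤∸1 (subst (suc k <_) l₂ sk<r₂))))
  (λ k → !-≤-inside r₃ k λ k<r₃ → subst (λ i → r₃ ! i ≤ r₂ ! k) (ℕₚ.+-identityʳ k)
           (coldec 2 (suc k) (s≤s z≤n) ℕₚ.≤-refl (s≤s z≤n) (subst (k <_) l₃ k<r₃)))
  (λ k → !-≤-inside r₁ (suc k) λ sk<r₁ → subst (λ i → r₁ ! i ≤ r₃ ! k) (cong (_∸ 1) (j+0+2≡2+j k))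
           (cycdec (suc k) (s≤s z≤n) (<⇒≤∸1 (subst (suc k <_) l₁ sk<r₁))))
  where
  open IsCylindric c
  l₁ = rowlen 1 (s≤s z≤n) (s≤s z≤n)
  l₂ = rowlen 2 (s≤s z≤n) (s≤s (s≤s z≤n))
  l₃ = rowlen 3 (s≤s z≤n) ℕₚ.≤-refl

Interlaced⇒IsCylindric₁ : ∀ L {h r₁ r₂ r₃} → length r₁ ≡ L → length r₂ ≡ L → length r₃ ≡ L →
                          Interlaced r₁ r₂ r₃ → r₁ ! 0 ≤ h → r₂ ! 0 ≤ h →
                          IsCylindric (shapeLa L 1) ((h ∷ r₁) ∷ r₂ ∷ r₃ ∷ [])
Interlaced⇒IsCylindric₁ L {h} {r₁} {r₂} {r₃} l₁ l₂ l₃ (mkInterlaced row₁ row₂ row₃ col₁₂ col₂₃ col₃₁) r₁≤h r₂≤h =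
  record
  { nrows  = refl
  ; rowlen = λ { 1 _ _ → cong suc l₁ ; 2 _ _ → l₂ ; 3 _ _ → l₃ ; (suc (suc (suc (suc i)))) _ (s≤s (s≤s (s≤s ()))) }
  ; rowdec = λ { 1 1 _ _ _ _ → r₁≤h ; 1 (suc (suc j)) _ _ _ _ → row₁ j
               ; 2 (suc j) _ _ _ _ → row₂ j ; 3 (suc j) _ _ _ _ → row₃ j
               ; (suc (suc (suc (suc i)))) _ _ (s≤s (s≤s (s≤s ()))) }
  ; coldec = λ { 1 1 _ _ _ _ → r₂≤h
               ; 1 (suc (suc j)) _ _ _ _ → subst (λ k → r₂ ! k ≤ r₁ ! j) (sym (ℕₚ.+-identityʳ (suc j))) (col₁₂ j)
               ; 2 (suc j) _ _ _ _ → subst (λ k → r₃ ! k ≤ r₂ ! j) (sym (ℕₚ.+-identityʳ j)) (col₂₃ j)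
               ; (suc (suc (suc i))) _ _ (s≤s (s≤s (s≤s ()))) }
  ; cycdec = λ { (suc j) _ _ → subst (λ k → (h ∷ r₁) ! k ≤ r₃ ! j) (sym (j+0+2≡2+j j)) (col₃₁ j) }
  }

IsCylindric₁⇒Interlaced : ∀ L {h r₁ r₂ r₃} → IsCylindric (shapeLa L 1) ((h ∷ r₁) ∷ r₂ ∷ r₃ ∷ []) →
                          (length r₁ ≡ L × length r₂ ≡ L × length r₃ ≡ L) ×
                          Interlaced r₁ r₂ r₃ × r₁ ! 0 ≤ h × r₂ ! 0 ≤ h
IsCylindric₁⇒Interlaced L {h} {r₁} {r₂} {r₃} c = (l₁ , l₂ , l₃) , mkInterlaced
  (λ k → !-≤-inside r₁ (suc k) λ sk<r₁ → rowdec 1 (suc (suc k)) (s≤s z≤n) (s≤s z≤n) (s≤s z≤n) (s≤s sk<r₁))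
  (λ k → !-≤-inside r₂ (suc k) (rowdec 2 (suc k) (s≤s z≤n) (s≤s (s≤s z≤n)) (s≤s z≤n)))
  (λ k → !-≤-inside r₃ (suc k) (rowdec 3 (suc k) (s≤s z≤n) ℕₚ.≤-refl (s≤s z≤n)))
  (λ k → !-≤-inside r₂ (suc k) λ sk<r₂ → subst (λ i → r₂ ! i ≤ r₁ ! k) (ℕₚ.+-identityʳ (suc k))
           (coldec 1 (suc (suc k)) (s≤s z≤n) (s≤s (s≤s z≤n)) (s≤s z≤n) (subst (suc k <_) l₂ sk<r₂)))
  (λ k → !-≤-inside r₃ k λ k<r₃ → subst (λ i → r₃ ! i ≤ r₂ ! k) (ℕₚ.+-identityʳ k)
           (coldec 2 (suc k) (s≤s z≤n) ℕₚ.≤-refl (s≤s z≤n) (subst (k <_) l₃ k<r₃)))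
  (λ k → !-≤-inside r₁ (suc k) λ sk<r₁ → subst (λ i → (h ∷ r₁) ! i ≤ r₃ ! k) (j+0+2≡2+j k)
           (cycdec (suc k) (s≤s z≤n) (<⇒≤∸1 (subst (suc k <_) l₁ sk<r₁)))) ,
  !-≤-inside r₁ 0 (λ 0<r₁ → rowdec 1 1 (s≤s z≤n) (s≤s z≤n) (s≤s z≤n) (s≤s 0<r₁)) ,
  !-≤-inside r₂ 0 (λ 0<r₂ → coldec 1 1 (s≤s z≤n) (s≤s (s≤s z≤n)) (s≤s z≤n) (subst (0 <_) l₂ 0<r₂))
  where
  open IsCylindric c
  l₁ = ℕₚ.suc-injective (rowlen 1 (s≤s z≤n) (s≤s z≤n))
  l₂ = rowlen 2 (s≤s z≤n) (s≤s (s≤s z≤n))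
  l₃ = rowlen 3 (s≤s z≤n) ℕₚ.≤-refl

CylindricWith : Shape → ℕ → ℕ → List (List ℕ) → Set
CylindricWith s m N ν = IsCylindric s ν × maxEntry ν ≡ m × size ν ≡ N

three-rows : ∀ {s ν} → rank s ≡ 3 → IsCylindric s ν →
             Σ[ r₁ ∈ List ℕ ] Σ[ r₂ ∈ List ℕ ] Σ[ r₃ ∈ List ℕ ] ν ≡ r₁ ∷ r₂ ∷ r₃ ∷ []
three-rows {ν = r₁ ∷ r₂ ∷ r₃ ∷ []} _ _ = r₁ , r₂ , r₃ , refl
three-rows {ν = []}                     s3 c = case trans (IsCylindric.nrows c) s3 of λ ()
three-rows {ν = _ ∷ []}                 s3 c = case trans (IsCylindric.nrows c) s3 of λ ()
three-rows {ν = _ ∷ _ ∷ []}             s3 c = case trans (IsCylindric.nrows c) s3 of λ ()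
three-rows {ν = _ ∷ _ ∷ _ ∷ _ ∷ _}      s3 c = case trans (IsCylindric.nrows c) s3 of λ ()

rows₀ : List ℕ → List (List ℕ)
rows₀ x = strand 1 x ∷ strand 0 x ∷ strand 2 x ∷ []

fromRows₀ : List (List ℕ) → List ℕ
fromRows₀ ν = weave (row ν 2) (row ν 1) (row ν 3)

rows₀-weave : ∀ {r₁ r₂ r₃} → Aligned r₂ r₁ r₃ → rows₀ (weave r₂ r₁ r₃) ≡ r₁ ∷ r₂ ∷ r₃ ∷ []
rows₀-weave al with strand-weave al
... | e₂ , e₁ , e₃ = cong₂ _∷_ e₁ (cong₂ _∷_ e₂ (cong (_∷ []) e₃))

3L+0≡L*3 : ∀ L → 3 * L + 0 ≡ L * 3
3L+0≡L*3 L = trans (ℕₚ.+-identityʳ (3 * L)) (ℕₚ.*-comm 3 L)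

3L+1≡1+L*3 : ∀ L → 3 * L + 1 ≡ suc (L * 3)
3L+1≡1+L*3 L = trans (ℕₚ.+-comm (3 * L) 1) (cong suc (ℕₚ.*-comm 3 L))

fence⇒cylindric₀ : ∀ L {m N x} → FenceWith 0 (3 * L + 0) m N x →
                   CylindricWith (shapeLa L 0) m N (rows₀ x) × fromRows₀ (rows₀ x) ≡ x
fence⇒cylindric₀ L {x = x} (fenceWith (mkIsFence lx fx _) refl refl)
  with weave-strand L x (trans lx (3L+0≡L*3 L))
... | al , x≡ , l₀ =
  ( Interlaced⇒IsCylindric₀ L (trans (proj₁ (aligned-lengths al)) l₀) l₀ (trans (proj₂ (aligned-lengths al)) l₀)
      (Fence-weave⁻ al (subst Fence (sym x≡) fx))
  , trans (sym (listMax-weave al)) (cong listMax x≡)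
  , trans (sym (sum-weave al)) (cong sum x≡) )
  , x≡

cylindric⇒fence₀ : ∀ L {m N ν} → CylindricWith (shapeLa L 0) m N ν →
                   FenceWith 0 (3 * L + 0) m N (fromRows₀ ν) × rows₀ (fromRows₀ ν) ≡ ν
cylindric⇒fence₀ L (c , refl , refl) with three-rows refl c
... | r₁ , r₂ , r₃ , refl with IsCylindric₀⇒Interlaced L c
...   | (l₁ , l₂ , l₃) , il =
  fenceWith (mkIsFence (trans (length-weave al) (trans (cong (_* 3) l₂) (sym (3L+0≡L*3 L))))
                       (Fence-weave⁺ al il) tt)
            (listMax-weave al) (sum-weave al) ,
  rows₀-weave al
  where
  al : Aligned r₂ r₁ r₃
  al = aligned r₂ r₁ r₃ (trans l₁ (sym l₂)) (trans l₃ (sym l₂))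

-- The junk value rows₁ [] is never used: the fences counted for a = 1 have length 3L + 1.
rows₁ : List ℕ → List (List ℕ)
rows₁ []      = rows₀ []
rows₁ (h ∷ x) = (h ∷ strand 1 x) ∷ strand 0 x ∷ strand 2 x ∷ []

fromRows₁ : List (List ℕ) → List ℕ
fromRows₁ ν = row ν 1 ! 0 ∷ weave (row ν 2) (drop 1 (row ν 1)) (row ν 3)

fence⇒cylindric₁ : ∀ L {m N x} → FenceWith 1 (3 * L + 1) m N x →
                   CylindricWith (shapeLa L 1) m N (rows₁ x) × fromRows₁ (rows₁ x) ≡ x
fence⇒cylindric₁ L {x = []}    (fenceWith (mkIsFence lx _ _) _ _) = case trans lx (3L+1≡1+L*3 L) of λ ()
fence⇒cylindric₁ L {x = h ∷ x} (fenceWith (mkIsFence lx fhx x₀≤h) refl refl)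
  with weave-strand L x (ℕₚ.suc-injective (trans lx (3L+1≡1+L*3 L))) | Fence-∷⁻ fhx
... | al , x≡ , l₀ | fx , x₁≤h , x₂≤h =
  ( Interlaced⇒IsCylindric₁ L (trans (proj₁ (aligned-lengths al)) l₀) l₀ (trans (proj₂ (aligned-lengths al)) l₀)
      (Fence-weave⁻ al (subst Fence (sym x≡) fx))
      (subst (_≤ h) (trans (cong (_! 1) (sym x≡)) (proj₁ (proj₂ (!-weave al 0)))) x₁≤h)
      (subst (_≤ h) (trans (cong (_! 0) (sym x≡)) (proj₁ (!-weave al 0))) x₀≤h)
  , trans (ℕₚ.⊔-assoc h _ _) (cong (h ⊔_) (trans (sym (listMax-weave al)) (cong listMax x≡)))
  , trans (ℕₚ.+-assoc h _ _) (cong (_+_ h) (trans (sym (sum-weave al)) (cong sum x≡))) )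
  , cong (h ∷_) x≡

cylindric⇒fence₁ : ∀ L {m N ν} → CylindricWith (shapeLa L 1) m N ν →
                   FenceWith 1 (3 * L + 1) m N (fromRows₁ ν) × rows₁ (fromRows₁ ν) ≡ ν
cylindric⇒fence₁ L (c , refl , refl) with three-rows refl c
... | []      , r₂ , r₃ , refl = case IsCylindric.rowlen c 1 (s≤s z≤n) (s≤s z≤n) of λ ()
... | h ∷ r₁ , r₂ , r₃ , refl with IsCylindric₁⇒Interlaced L c
...   | (l₁ , l₂ , l₃) , il , r₁≤h , r₂≤h =
  fenceWith (mkIsFence (trans (cong suc (trans (length-weave al) (cong (_* 3) l₂))) (sym (3L+1≡1+L*3 L)))
                       (Fence-∷⁺ (Fence-weave⁺ al il)
                          (subst (_≤ h) (sym (proj₁ (proj₂ (!-weave al 0)))) r₁≤h)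
                          (subst (_≤ h) (sym (proj₂ (proj₂ (!-weave al 0)))) (ℕₚ.≤-trans (Interlaced.col₂₃ il 0) r₂≤h)))
                       (subst (_≤ h) (sym (proj₁ (!-weave al 0))) r₂≤h))
            (trans (cong (h ⊔_) (listMax-weave al)) (sym (ℕₚ.⊔-assoc h _ _)))
            (trans (cong (_+_ h) (sum-weave al)) (sym (ℕₚ.+-assoc h _ _))) ,
  cong (λ { (r ∷ ν) → (h ∷ r) ∷ ν ; [] → [] }) (rows₀-weave al)
  where
  al : Aligned r₂ r₁ r₃
  al = aligned r₂ r₁ r₃ (trans l₁ (sym l₂)) (trans l₃ (sym l₂))

CountIs-fences : ∀ {a} → a ≤ 1 → ∀ L m N → CountIs (shapeLa L a) m N (length (fences a (3 * L + a) m N))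
CountIs-fences z≤n L m N = map rows₀ (fences 0 (3 * L + 0) m N) , length-map rows₀ (fences 0 (3 * L + 0) m N) ,
  Enumerates-bijection rows₀ fromRows₀ (fence⇒cylindric₀ L) (cylindric⇒fence₀ L) (fences-enumerate 0 (3 * L + 0) m N)
CountIs-fences (s≤s z≤n) L m N = map rows₁ (fences 1 (3 * L + 1) m N) , length-map rows₁ (fences 1 (3 * L + 1) m N) ,
  Enumerates-bijection rows₁ fromRows₁ (fence⇒cylindric₁ L) (cylindric⇒fence₁ L) (fences-enumerate 1 (3 * L + 1) m N)

proposition7p6 : (L a : ℕ) → a ≤ 1 →
    Σ[ g ∈ (ℕ → ℕ → ℕ) ] ((∀ m N → CountIs (shapeLa L a) m N (g m N)) ×
            (∀ m N → mul (λ i t → + g i t) (pochZQ (3 * L + a)) m N ≡ rhsSeries L a m N))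
proposition7p6 L a a≤1 = (λ m N → length (fences a (3 * L + a) m N)) , CountIs-fences a≤1 L , λ m N →
  trans (mul-pochZQʳ (3 * L + a) (count (fences a (3 * L + a))) m N) (pochCount≈binomialSum a≤1 (3 * L) m N)
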